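{- Let $h$ be an even positive integer and $c$ an even positive integer. Let $T$ be the rooted tree of depth $h$ in which every vertex at depth $0,\dots,h/2-1$ has $3$ children and every vertex at depth $h/2,\dots,h-1$ has $2$ children ($n=6^{h/2}$ leaves), and for $0\le s\le h$ let $\lambda(s)=2^s$ if $s\le h/2$ and $\lambda(s)=2^{h/2}3^{s-h/2}$ if $h/2<s\le h$ (the number of leaves of a subtree rooted at depth $h-s$). Let $A$ be a graph on $2n$ vertices in which every vertex has degree $3$. Let $G$ be obtained from disjoint copies $T_{\mathsf L},T_{\mathsf R}$ of $T$ and $A$ by adding a vertex $v^*$ adjacent to both roots, joining each of the $2n$ leaves to its image under a fixed bijection onto $V(A)$ by a path of length $c$ (new internal vertices), and replacing every edge of $A$ by a path of length $c$. Fix a leaf $u$ of $T_{\mathsf L}$ and let $\mathcal P$ be the set of simple paths in $G\setminus\{v^*\}$ from $u$ to a leaf of $T_{\mathsf R}$. Then for every $r\ge1$ and every sequence $(t_1,\dots,t_{2r+1})$ of non-negative integers, the number of paths $P\in\mathcal P$ of rank $r$ with pattern $(t_1,\dots,t_{2r+1})$ is at most $$\left(\tfrac{3}{2}\right)^{r}\left[\prod_{i=1}^{r}\lambda(t_{2i-1})\,2^{t_{2i}}\right]\lambda(t_{2r+1}).$$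
   Context: Each $P\in\mathcal P$ decomposes as: a tree segment, a connecting path of length $c$ into a vertex of $A$, an expander segment (travelling between vertices of $A$ along the length-$c$ paths replacing edges of $A$), a connecting path of length $c$ to a leaf, a tree segment, and so on, ending with a tree segment at a leaf of $T_{\mathsf R}$. The rank $r$ of $P$ is the number of expander segments (the number of times $P$ enters and leaves the subdivided copy of $A$); there are then $r+1$ tree segments, each lying in $T_{\mathsf L}$ or $T_{\mathsf R}$, starting and ending at leaves, the first and last possibly of length $0$. The pattern of $P$ is $(t_1,\dots,t_{2r+1})$, where $2t_{2i-1}$ is the length of the $i$-th tree segment ($1\le i\le r+1$) and $c\,t_{2i}$ is the length of the $i$-th expander segment ($1\le i\le r$). -}

module Defs where

open import Data.Nat using (ℕ; zero; suc; _+_; _*_; _∸_; _^_; _≤_; _<_; _<ᵇ_; _≡ᵇ_; _≤ᵇ_)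
open import Data.Bool using (Bool; true; false; _∧_; if_then_else_; T)
open import Data.Fin using (Fin; toℕ)
open import Data.List using (List; []; _∷_; length; _∷ʳ_; filter; map)
open import Data.List.Relation.Unary.Linked using (Linked)
open import Data.List.Relation.Unary.Unique.Propositional using (Unique)
open import Data.List.Membership.Propositional using (_∈_; _∉_)
open import Data.Product using (Σ; _×_; _,_; proj₂)
open import Data.Sum using (_⊎_)
open import Function.Bundles using (_↔_; Inverse; _⇔_)
open import Relation.Binary.PropositionalEquality using (_≡_)

-- Conventions: h = 2 * k (k ≥ 1), c = 2 * m (m ≥ 1).

nA : ℕ → ℕ
nA k = 2 * 6 ^ k

branch : ℕ → ℕ → ℕ
branch k d = if d <ᵇ k then 3 else 2

-- Vertices of T are addresses = lists of child indices, stored REVERSED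
-- (head = last step from the root).  The root is [].
validT : ℕ → List ℕ → Bool
validT k [] = true
validT k (i ∷ a) = (length a <ᵇ 2 * k) ∧ (i <ᵇ branch k (length a)) ∧ validT k a

isLeaf : ℕ → List ℕ → Bool
isLeaf k a = validT k a ∧ (length a ≡ᵇ 2 * k)

data Side : Set where
  L R : Side

Leaf : ℕ → Set
Leaf k = Σ (Side × List ℕ) (λ p → T (isLeaf k (proj₂ p)))

IsCubic : {N : ℕ} → (Fin N → Fin N → Bool) → Set
IsCubic {N} adj =
  (∀ x y → adj x y ≡ adj y x) ×
  (∀ x → adj x x ≡ false) ×
  (∀ x → Σ (List (Fin N)) λ ns →
     length ns ≡ 3 × Unique ns × (∀ y → (T (adj x y) ⇔ (y ∈ ns))))

-- Vertices of G.
--   star        : v*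
--   tr s a      : tree vertex with address a in T_s
--   leg s a j   : j-th internal vertex (0 ≤ j ≤ c-2) of the connecting path of leaf a of T_s
--   av x        : vertex x of A
--   ev x y j    : j-th internal vertex (0 ≤ j ≤ c-2) of the path replacing edge xy
--                 of A (x < y), counted from x
data V (N : ℕ) : Set where
  star : V N
  tr   : Side → List ℕ → V N
  leg  : Side → List ℕ → ℕ → V N
  av   : Fin N → V N
  ev   : Fin N → Fin N → ℕ → V N

module Graph (k m : ℕ) (adj : Fin (nA k) → Fin (nA k) → Bool)
             (σ : Leaf k ↔ Fin (nA k)) where

  c : ℕ
  c = 2 * m

  N : ℕ
  N = nA k

  -- directed version of the edges of G
  data Step : V N → V N → Set where
    s-root : ∀ s → Step star (tr s [])
    s-tree : ∀ s i a → T (validT k (i ∷ a)) → Step (tr s a) (tr s (i ∷ a))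
    s-leaf : ∀ s a → T (isLeaf k a) → Step (tr s a) (leg s a 0)
    s-leg  : ∀ s a j → T (isLeaf k a) → suc j < c ∸ 1 →
             Step (leg s a j) (leg s a (suc j))
    s-legA : ∀ s a (p : T (isLeaf k a)) →
             Step (leg s a (c ∸ 2)) (av (Inverse.to σ ((s , a) , p)))
    s-a    : ∀ x y → T (adj x y) → toℕ x < toℕ y → Step (av x) (ev x y 0)
    s-e    : ∀ x y j → T (adj x y) → toℕ x < toℕ y → suc j < c ∸ 1 →
             Step (ev x y j) (ev x y (suc j))
    s-eA   : ∀ x y → T (adj x y) → toℕ x < toℕ y → Step (ev x y (c ∸ 2)) (av y)

  Adj : V N → V N → Set
  Adj v w = Step v w ⊎ Step w v

  InPaths : List ℕ → List (V N) → Set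
  InPaths u P =
    Σ (List (V N)) λ mid → Σ (List ℕ) λ w →
      T (isLeaf k w) × (P ≡ tr L u ∷ (mid ∷ʳ tr R w)) ×
      Linked Adj P × Unique P × star ∉ P

-- Classification of vertices: tree, connecting path, expander (subdivided A).
data Cls : Set where
  cT cC cX : Cls

cls : {N : ℕ} → V N → Cls
cls star        = cT
cls (tr _ _)    = cT
cls (leg _ _ _) = cC
cls (av _)      = cX
cls (ev _ _ _)  = cX

_==ᶜ_ : Cls → Cls → Bool
cT ==ᶜ cT = true
cC ==ᶜ cC = true
cX ==ᶜ cX = true
_  ==ᶜ _  = false

-- maximal runs of consecutive vertices of the same class: (class, #vertices)
blocks : {N : ℕ} → List (V N) → List (Cls × ℕ)
blocks [] = []
blocks (v ∷ vs) with blocks vs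
... | [] = (cls v , 1) ∷ []
... | (d , n) ∷ rest =
  if cls v ==ᶜ d then (d , suc n) ∷ rest else (cls v , 1) ∷ (d , n) ∷ rest

-- segments = non-connector blocks, with their lengths (in edges), in order
segments : List (Cls × ℕ) → List (Cls × ℕ)
segments [] = []
segments ((cC , n) ∷ bs) = segments bs
segments ((d , n) ∷ bs) = (d , n ∸ 1) ∷ segments bs

countX : List (Cls × ℕ) → ℕ
countX [] = 0
countX ((cX , _) ∷ bs) = suc (countX bs)
countX (_ ∷ bs) = countX bs

rank : {N : ℕ} → List (V N) → ℕ
rank P = countX (segments (blocks P))

mutual
  scaleT : ℕ → List ℕ → List (Cls × ℕ)
  scaleT c [] = []
  scaleT c (t ∷ ts) = (cT , 2 * t) ∷ scaleX c ts

  scaleX : ℕ → List ℕ → List (Cls × ℕ)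
  scaleX c [] = []
  scaleX c (t ∷ ts) = (cX , c * t) ∷ scaleT c ts

HasPattern : {N : ℕ} → ℕ → List (V N) → List ℕ → Set
HasPattern c P ts = segments (blocks P) ≡ scaleT c ts

lam : ℕ → ℕ → ℕ
lam k s = if s ≤ᵇ k then 2 ^ s else 2 ^ k * 3 ^ (s ∸ k)

bound : ℕ → List ℕ → ℕ
bound k [] = 1
bound k (t ∷ []) = lam k t
bound k (t ∷ e ∷ ts) = lam k t * 2 ^ e * bound k ts

module Submission where

-- A path P ∈ 𝒫 is read vertex by vertex, and every prefix is summarised
-- by a finite "mode" (ascending or descending in a tree at a given height, walking along
-- a connecting path, standing on a vertex of A, travelling along a subdivided edge of A)
-- together with the list S of segments (class and remaining length) still to be
-- traversed.  To every mode and S we attach a potential `pot mode S`, and we show by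
-- induction on the remaining length that the number of admissible continuations,
-- weighted by 2^(number of expander segments of S), is at most that potential.
-- Each inductive step splits the continuations by their next vertex (the general
-- counting lemma `CountByHead.countByHead`) and compares the sum of the potentials of
-- the successor modes with the current potential; the tree steps use that one step up
-- the tree multiplies λ by the branching number, the expander steps use that A is cubic,
-- so a vertex of A has at most 3 exits on entering A and at most 2 afterwards.
-- For the start vertex u the potential is ∏ λ(t_odd) ∏ 3·2^(t_even) = 3^r · bound k ts,
-- while the weight is 2^r; this is the theorem.

open import Defs
open import Data.Nat using (ℕ; zero; suc; _+_; _*_; _∸_; _^_; _≤_; _<_; z≤n; s≤s; s≤s⁻¹;
  _<ᵇ_; _≤ᵇ_; _≡ᵇ_; ⌊_/2⌋; NonZero; _⊔_)
open import Data.Nat.Properties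
open import Data.Nat.DivMod using (_/_; +-distrib-/-∣ʳ; n/n≡1; 0/n≡0; m*n/n≡m)
open import Data.Nat.Divisibility using (∣-refl)
open import Data.Nat.ListAction using (sum)
open import Data.Nat.Solver using (module +-*-Solver)
open import Data.Bool using (Bool; true; false; T; if_then_else_)
open import Data.Bool.Properties using (T-irrelevant; T-∧)
open import Data.Fin using (Fin; toℕ)
import Data.Fin.Properties as FinP
open import Data.List using (List; []; _∷_; length; map; _++_; _∷ʳ_; upTo; filter)
import Data.List.Properties as ListP
open import Data.List.Relation.Unary.All using (All; []; _∷_)
import Data.List.Relation.Unary.All as All
open import Data.List.Relation.Unary.Any using (here; there)
import Data.List.Relation.Unary.Any as Any
open import Data.List.Relation.Unary.AllPairs using ([]; _∷_)
open import Data.List.Relation.Unary.Linked using (Linked; _∷_)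
open import Data.List.Relation.Unary.Unique.Propositional using (Unique)
open import Data.List.Membership.Propositional using (_∈_; _∉_)
open import Data.List.Membership.Propositional.Properties
  using (∈-++⁺ˡ; ∈-++⁺ʳ; ∈-++⁻; ∈-map⁺; ∈-map⁻; ∈-upTo⁺; ∈-filter⁺; ∈-filter⁻)
open import Data.Maybe using (Maybe; just; nothing)
open import Data.Product using (Σ; _×_; _,_; proj₁; proj₂)
open import Data.Sum using (_⊎_; inj₁; inj₂)
open import Data.Empty using (⊥; ⊥-elim)
open import Data.Unit using (tt)
open import Function using (case_of_)
open import Function.Bundles using (_↔_; Inverse; Equivalence)
open import Relation.Nullary using (¬_; Dec; yes; no; ¬?)
open import Relation.Binary.Definitions using (DecidableEquality; tri<; tri≈; tri>)
open import Relation.Binary.PropositionalEquality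

module CountByHead {A : Set} (_≟_ : DecidableEquality A) where

  tailsFrom : A → List (List A) → List (List A)
  tailsFrom x [] = []
  tailsFrom x ([] ∷ Qs) = tailsFrom x Qs
  tailsFrom x ((y ∷ Q) ∷ Qs) with y ≟ x
  ... | yes _ = Q ∷ tailsFrom x Qs
  ... | no _ = tailsFrom x Qs

  notFrom : A → List (List A) → List (List A)
  notFrom x [] = []
  notFrom x ([] ∷ Qs) = [] ∷ notFrom x Qs
  notFrom x ((y ∷ Q) ∷ Qs) with y ≟ x
  ... | yes _ = notFrom x Qs
  ... | no _ = (y ∷ Q) ∷ notFrom x Qs

  length-split : ∀ x Qs → length Qs ≡ length (tailsFrom x Qs) + length (notFrom x Qs)
  length-split x [] = refl
  length-split x ([] ∷ Qs) = trans (cong suc (length-split x Qs)) (sym (+-suc _ _))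
  length-split x ((y ∷ Q) ∷ Qs) with y ≟ x
  ... | yes _ = cong suc (length-split x Qs)
  ... | no _ = trans (cong suc (length-split x Qs)) (sym (+-suc _ _))

  tailsFrom-All : ∀ {P : List A → Set} x Qs → All P Qs → All (λ Q → P (x ∷ Q)) (tailsFrom x Qs)
  tailsFrom-All x [] [] = []
  tailsFrom-All x ([] ∷ Qs) (_ ∷ ps) = tailsFrom-All x Qs ps
  tailsFrom-All x ((y ∷ Q) ∷ Qs) (p ∷ ps) with y ≟ x
  ... | yes refl = p ∷ tailsFrom-All x Qs ps
  ... | no _ = tailsFrom-All x Qs ps

  notFrom-All : ∀ {P : List A → Set} x Qs → All P Qs →
                All (λ Q → P Q × (∀ {Q'} → Q ≢ x ∷ Q')) (notFrom x Qs)
  notFrom-All x [] [] = []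
  notFrom-All x ([] ∷ Qs) (p ∷ ps) = (p , λ ()) ∷ notFrom-All x Qs ps
  notFrom-All x ((y ∷ Q) ∷ Qs) (p ∷ ps) with y ≟ x
  ... | yes _ = notFrom-All x Qs ps
  ... | no y≢x = (p , λ eq → y≢x (ListP.∷-injectiveˡ eq)) ∷ notFrom-All x Qs ps

  tailsFrom-≢ : ∀ x Q Qs → All (λ Q' → x ∷ Q ≢ Q') Qs → All (λ Q' → Q ≢ Q') (tailsFrom x Qs)
  tailsFrom-≢ x Q [] [] = []
  tailsFrom-≢ x Q ([] ∷ Qs) (_ ∷ ps) = tailsFrom-≢ x Q Qs ps
  tailsFrom-≢ x Q ((y ∷ Q') ∷ Qs) (p ∷ ps) with y ≟ x
  ... | yes refl = (λ eq → p (cong (x ∷_) eq)) ∷ tailsFrom-≢ x Q Qs ps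
  ... | no _ = tailsFrom-≢ x Q Qs ps

  tailsFrom-Unique : ∀ x Qs → Unique Qs → Unique (tailsFrom x Qs)
  tailsFrom-Unique x [] [] = []
  tailsFrom-Unique x ([] ∷ Qs) (_ ∷ u) = tailsFrom-Unique x Qs u
  tailsFrom-Unique x ((y ∷ Q) ∷ Qs) (a ∷ u) with y ≟ x
  ... | yes refl = tailsFrom-≢ x Q Qs a ∷ tailsFrom-Unique x Qs u
  ... | no _ = tailsFrom-Unique x Qs u

  notFrom-≢ : ∀ x Q Qs → All (λ Q' → Q ≢ Q') Qs → All (λ Q' → Q ≢ Q') (notFrom x Qs)
  notFrom-≢ x Q [] [] = []
  notFrom-≢ x Q ([] ∷ Qs) (p ∷ ps) = p ∷ notFrom-≢ x Q Qs ps
  notFrom-≢ x Q ((y ∷ Q') ∷ Qs) (p ∷ ps) with y ≟ x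
  ... | yes _ = notFrom-≢ x Q Qs ps
  ... | no _ = p ∷ notFrom-≢ x Q Qs ps

  notFrom-Unique : ∀ x Qs → Unique Qs → Unique (notFrom x Qs)
  notFrom-Unique x [] [] = []
  notFrom-Unique x ([] ∷ Qs) (a ∷ u) = notFrom-≢ x [] Qs a ∷ notFrom-Unique x Qs u
  notFrom-Unique x ((y ∷ Q) ∷ Qs) (a ∷ u) with y ≟ x
  ... | yes _ = notFrom-Unique x Qs u
  ... | no _ = notFrom-≢ x (y ∷ Q) Qs a ∷ notFrom-Unique x Qs u

  -- a duplicate-free family with no non-empty member has at most one member, []
  countEmpty : ∀ {P : List A → Set} (W e : ℕ) Qs → Unique Qs → All P Qs →
               (P [] → W ≤ e) → (∀ {y Q} → ¬ P (y ∷ Q)) → W * length Qs ≤ e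
  countEmpty W e [] _ _ _ _ = subst (_≤ e) (sym (*-zeroʳ W)) z≤n
  countEmpty W e ((y ∷ Q) ∷ Qs) _ (p ∷ _) _ noCons = ⊥-elim (noCons p)
  countEmpty W e ([] ∷ []) _ (p ∷ _) empty _ = subst (_≤ e) (sym (*-identityʳ W)) (empty p)
  countEmpty W e ([] ∷ (y ∷ Q) ∷ Qs) _ (_ ∷ p ∷ _) _ noCons = ⊥-elim (noCons p)
  countEmpty W e ([] ∷ [] ∷ Qs) ((ne ∷ _) ∷ _) _ _ _ = ⊥-elim (ne refl)

  countByHead :
    ∀ {P : List A → Set} (W e : ℕ) (cands : List (A × ℕ)) Qs → Unique Qs → All P Qs →
    (P [] → W ≤ e) →
    (∀ {y Q} → P (y ∷ Q) → Σ ℕ λ b → (y , b) ∈ cands) →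
    (∀ {y b} → (y , b) ∈ cands → ∀ Qs' → Unique Qs' → All (λ Q → P (y ∷ Q)) Qs' →
       W * length Qs' ≤ b) →
    W * length Qs ≤ e + sum (map proj₂ cands)
  countByHead W e [] Qs u ps empty covered _ =
    subst (W * length Qs ≤_) (sym (+-identityʳ e))
      (countEmpty W e Qs u ps empty (λ p → case proj₂ (covered p) of λ ()))
  countByHead {P} W e ((x , b) ∷ cands) Qs u ps empty covered bounded = begin
      W * length Qs
        ≡⟨ cong (W *_) (length-split x Qs) ⟩
      W * (length (tailsFrom x Qs) + length (notFrom x Qs))
        ≡⟨ *-distribˡ-+ W _ _ ⟩
      W * length (tailsFrom x Qs) + W * length (notFrom x Qs)
        ≤⟨ +-mono-≤ (bounded (here refl) _ (tailsFrom-Unique x Qs u) (tailsFrom-All x Qs ps)) rest ⟩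
      b + (e + sum (map proj₂ cands))
        ≡⟨ +-comm b _ ⟩
      (e + sum (map proj₂ cands)) + b
        ≡⟨ +-assoc e _ b ⟩
      e + (sum (map proj₂ cands) + b)
        ≡⟨ cong (e +_) (+-comm _ b) ⟩
      e + (b + sum (map proj₂ cands)) ∎
    where
    open ≤-Reasoning
    coveredRest : ∀ {y Q} → P (y ∷ Q) × (∀ {Q'} → y ∷ Q ≢ x ∷ Q') → Σ ℕ λ b' → (y , b') ∈ cands
    coveredRest (p , ne) with covered p
    ... | _ , here refl = ⊥-elim (ne refl)
    ... | b' , there mem = b' , mem
    rest : W * length (notFrom x Qs) ≤ e + sum (map proj₂ cands)
    rest = countByHead W e cands (notFrom x Qs) (notFrom-Unique x Qs u) (notFrom-All x Qs ps)
             (λ p → empty (proj₁ p)) coveredRest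
             (λ mem Qs' u' ps' → bounded (there mem) Qs' u' (All.map proj₁ ps'))

-- Facts about λ and the branching numbers of T (h = 2k).  Heights are measured from the
-- leaves: a vertex at depth d has height 2k - d, and λ(e) leaves below it.
module LeafCounts (k : ℕ) where

  T-true : ∀ {b} → b ≡ true → T b
  T-true refl = tt

  T-false : ∀ {b} → b ≡ false → ¬ T b
  T-false refl ()

  true-T : ∀ {b} → T b → b ≡ true
  true-T {true} _ = refl

  false-¬T : ∀ {b} → ¬ T b → b ≡ false
  false-¬T {false} _ = refl
  false-¬T {true} f = ⊥-elim (f tt)

  lam-low : ∀ {e} → e ≤ k → lam k e ≡ 2 ^ e
  lam-low {e} le rewrite true-T (≤⇒≤ᵇ {e} {k} le) = refl

  lam-high : ∀ {e} → k < e → lam k e ≡ 2 ^ k * 3 ^ (e ∸ k)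
  lam-high {e} lt rewrite false-¬T (λ t → <⇒≱ lt (≤ᵇ⇒≤ e k t)) = refl

  branch-top : ∀ {d} → d < k → branch k d ≡ 3
  branch-top {d} lt rewrite true-T (<⇒<ᵇ {d} {k} lt) = refl

  branch-bottom : ∀ {d} → k ≤ d → branch k d ≡ 2
  branch-bottom {d} le rewrite false-¬T (λ t → <⇒≱ (<ᵇ⇒< d k t) le) = refl

  -- the leaves below a vertex at depth d are those below its branch k d children
  branch*lam : ∀ d e → suc e + d ≡ 2 * k → branch k d * lam k e ≡ lam k (suc e)
  branch*lam d e eq with d <? k
  ... | no d≮k = begin
        branch k d * lam k e ≡⟨ cong₂ _*_ (branch-bottom (≮⇒≥ d≮k)) (lam-low (≤-trans (n≤1+n e) 1+e≤k)) ⟩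
        2 * 2 ^ e ≡⟨ sym (lam-low 1+e≤k) ⟩
        lam k (suc e) ∎
    where
    open ≡-Reasoning
    1+e≤k : suc e ≤ k
    1+e≤k = +-cancelʳ-≤ k (suc e) k
              (≤-trans (+-monoʳ-≤ (suc e) (≮⇒≥ d≮k)) (≤-reflexive (trans eq (cong (k +_) (+-identityʳ k)))))
  ... | yes d<k = begin
        branch k d * lam k e ≡⟨ cong (_* lam k e) (branch-top d<k) ⟩
        3 * lam k e ≡⟨ triple (m≤n⇒m<n∨m≡n k≤e) ⟩
        2 ^ k * 3 ^ (suc e ∸ k) ≡⟨ sym (lam-high (s≤s k≤e)) ⟩
        lam k (suc e) ∎
    where
    open ≡-Reasoning
    k≤e : k ≤ e
    k≤e = s≤s⁻¹ (+-cancelʳ-< d k (suc e)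
            (<-≤-trans (+-monoʳ-< k d<k) (≤-reflexive (trans (cong (k +_) (sym (+-identityʳ k))) (sym eq)))))
    triple : k < e ⊎ k ≡ e → 3 * lam k e ≡ 2 ^ k * 3 ^ (suc e ∸ k)
    triple (inj₁ lt) rewrite lam-high lt | +-∸-assoc 1 (<⇒≤ lt) =
      trans (sym (*-assoc 3 (2 ^ k) _)) (trans (cong (_* 3 ^ (e ∸ k)) (*-comm 3 (2 ^ k))) (*-assoc (2 ^ k) 3 _))
    triple (inj₂ refl) rewrite lam-low (≤-refl {k}) | m+n∸n≡m 1 k = *-comm 3 (2 ^ k)

  half-double : ∀ n → ⌊ n + n /2⌋ ≡ n
  half-double zero = refl
  half-double (suc n) rewrite +-suc n n = cong suc (half-double n)

  -- Potentials of the tree modes, for a tree segment with t steps left and potential φ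
  -- of the segments after it.  Ascending from height e, the walk can turn at any height
  -- ≥ e, and it reaches a leaf at height 0 exactly when it turns at height (t + e)/2.
  ascendPot : ℕ → ℕ → ℕ → ℕ
  ascendPot e t φ = if e ≤ᵇ t then lam k ⌊ t + e /2⌋ * φ else 0

  -- descending from height e, the remaining t steps must all go down
  descendPot : ℕ → ℕ → ℕ → ℕ
  descendPot e t φ = if e ≡ᵇ t then lam k e * φ else 0

  toParent : ℕ → ℕ → ℕ → ℕ
  toParent e zero φ = 0
  toParent e (suc t) φ = ascendPot (suc e) t φ

  toChild : ℕ → ℕ → ℕ → ℕ
  toChild zero t φ = 0
  toChild (suc e) zero φ = 0
  toChild (suc e) (suc t) φ = descendPot e t φ

  toLeg : ℕ → ℕ → ℕ → ℕ
  toLeg zero zero φC = φC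
  toLeg _ _ _ = 0

  stopHere : ℕ → ℕ → ℕ → ℕ
  stopHere zero zero ε = ε
  stopHere _ _ _ = 0

  -- The allowances of all possible next steps fit into the potential.  Here φC ≤ φ is the
  -- potential after leaving through a leg, ε the one of stopping, and br the branching.
  ascend-step : ∀ e t φ φC ε br → φC + ε ≤ φ → (∀ e' → e ≡ suc e' → br * lam k e' ≤ lam k (suc e')) →
    stopHere e t ε + (toParent e t φ + (br * toChild e t φ + (toLeg e t φC + 0))) ≤ ascendPot e t φ
  ascend-step zero zero φ φC ε br le h rewrite *-zeroʳ br | +-identityʳ φC | +-identityʳ φ =
    ≤-trans (≤-reflexive (+-comm ε φC)) le
  ascend-step (suc e) zero φ φC ε br le h rewrite *-zeroʳ br = z≤n
  ascend-step zero (suc t) φ φC ε br le h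
    rewrite *-zeroʳ br | +-identityʳ (ascendPot 1 t φ) | +-identityʳ t | +-comm t 1 with 0 <ᵇ t
  ... | true = ≤-refl
  ... | false = z≤n
  ascend-step (suc e) (suc t) φ φC ε br le h
    with suc (suc e) ≤ᵇ t in e1 | e ≡ᵇ t in e2 | suc e ≤ᵇ suc t in e3
  ... | true | _ | false =
    ⊥-elim (T-false e3 (≤⇒≤ᵇ {suc e} {suc t} (≤-trans (n≤1+n _) (≤-trans (≤ᵇ⇒≤ _ _ (T-true e1)) (n≤1+n t)))))
  ... | true | true | _ =
    ⊥-elim (<⇒≱ (≤ᵇ⇒≤ _ _ (T-true e1)) (≤-trans (≤-reflexive (sym (≡ᵇ⇒≡ e t (T-true e2)))) (n≤1+n e)))
  ... | true | false | true
    rewrite *-zeroʳ br | +-identityʳ (lam k ⌊ t + suc (suc e) /2⌋ * φ) | +-suc t (suc e) = ≤-refl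
  ... | false | false | _ rewrite *-zeroʳ br = z≤n
  ... | false | true | false = ⊥-elim (T-false e3 (≤⇒≤ᵇ {suc e} {suc t} (s≤s (≤-reflexive (≡ᵇ⇒≡ e t (T-true e2))))))
  ... | false | true | true with ≡ᵇ⇒≡ e t (T-true e2)
  ...   | refl rewrite +-identityʳ (br * (lam k e * φ)) | half-double (suc e) =
    ≤-trans (≤-reflexive (sym (*-assoc br (lam k e) φ))) (*-monoˡ-≤ φ (h e refl))

  descend-step : ∀ e t φ φC ε br → φC + ε ≤ φ → (∀ e' → e ≡ suc e' → br * lam k e' ≤ lam k (suc e')) →
    stopHere e t ε + (br * toChild e t φ + (toLeg e t φC + 0)) ≤ descendPot e t φ
  descend-step zero zero φ φC ε br le h rewrite *-zeroʳ br | +-identityʳ φC | +-identityʳ φ =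
    ≤-trans (≤-reflexive (+-comm ε φC)) le
  descend-step (suc e) zero φ φC ε br le h rewrite *-zeroʳ br = z≤n
  descend-step zero (suc t) φ φC ε br le h rewrite *-zeroʳ br = z≤n
  descend-step (suc e) (suc t) φ φC ε br le h with e ≡ᵇ t
  ... | false rewrite *-zeroʳ br = z≤n
  ... | true rewrite +-identityʳ (br * (lam k e * φ)) =
    ≤-trans (≤-reflexive (sym (*-assoc br (lam k e) φ))) (*-monoˡ-≤ φ (h e refl))

module Neighbourhoods (k m' : ℕ) (adj : Fin (nA k) → Fin (nA k) → Bool)
                      (σ : Leaf k ↔ Fin (nA k)) where

  open Graph k (suc m') adj σ public

  Vtx : Set
  Vtx = V N

  side≟ : DecidableEquality Side
  side≟ L L = yes refl
  side≟ R R = yes refl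
  side≟ L R = no λ ()
  side≟ R L = no λ ()

  _≟V_ : DecidableEquality Vtx
  star ≟V star = yes refl
  tr s a ≟V tr s' a' with side≟ s s' | ListP.≡-dec _≟_ a a'
  ... | yes refl | yes refl = yes refl
  ... | no ne | _ = no λ { refl → ne refl }
  ... | _ | no ne = no λ { refl → ne refl }
  leg s a j ≟V leg s' a' j' with side≟ s s' | ListP.≡-dec _≟_ a a' | j ≟ j'
  ... | yes refl | yes refl | yes refl = yes refl
  ... | no ne | _ | _ = no λ { refl → ne refl }
  ... | _ | no ne | _ = no λ { refl → ne refl }
  ... | _ | _ | no ne = no λ { refl → ne refl }
  av x ≟V av x' with x FinP.≟ x'
  ... | yes refl = yes refl
  ... | no ne = no λ { refl → ne refl }
  ev x y j ≟V ev x' y' j' with x FinP.≟ x' | y FinP.≟ y' | j ≟ j'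
  ... | yes refl | yes refl | yes refl = yes refl
  ... | no ne | _ | _ = no λ { refl → ne refl }
  ... | _ | no ne | _ = no λ { refl → ne refl }
  ... | _ | _ | no ne = no λ { refl → ne refl }
  star ≟V tr _ _ = no λ ()
  star ≟V leg _ _ _ = no λ ()
  star ≟V av _ = no λ ()
  star ≟V ev _ _ _ = no λ ()
  tr _ _ ≟V star = no λ ()
  tr _ _ ≟V leg _ _ _ = no λ ()
  tr _ _ ≟V av _ = no λ ()
  tr _ _ ≟V ev _ _ _ = no λ ()
  leg _ _ _ ≟V star = no λ ()
  leg _ _ _ ≟V tr _ _ = no λ ()
  leg _ _ _ ≟V av _ = no λ ()
  leg _ _ _ ≟V ev _ _ _ = no λ ()
  av _ ≟V star = no λ ()
  av _ ≟V tr _ _ = no λ ()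
  av _ ≟V leg _ _ _ = no λ ()
  av _ ≟V ev _ _ _ = no λ ()
  ev _ _ _ ≟V star = no λ ()
  ev _ _ _ ≟V tr _ _ = no λ ()
  ev _ _ _ ≟V leg _ _ _ = no λ ()
  ev _ _ _ ≟V av _ = no λ ()

  -- the internal vertices of a path of length c are indexed 0 … cLast
  cLast : ℕ
  cLast = c ∸ 2

  cLast≡ : cLast ≡ 2 * m'
  cLast≡ = cong (_∸ 2) (*-suc 2 m')

  c≡ : c ≡ suc (suc cLast)
  c≡ = trans (*-suc 2 m') (cong (2 +_) (sym cLast≡))

  c∸1≡ : c ∸ 1 ≡ suc cLast
  c∸1≡ = cong (_∸ 1) c≡

  c∸1-lt : ∀ {j} → suc j < c ∸ 1 → suc j ≤ cLast
  c∸1-lt {j} lt = s≤s⁻¹ (subst (suc (suc j) ≤_) c∸1≡ lt)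

  nbr-tr : ∀ {s a z} → Adj (tr s a) z →
    (a ≡ [] × z ≡ star) ⊎
    (Σ ℕ λ i → Σ (List ℕ) λ a' → a ≡ i ∷ a' × z ≡ tr s a' × T (validT k a)) ⊎
    (Σ ℕ λ i → T (validT k (i ∷ a)) × z ≡ tr s (i ∷ a)) ⊎
    (T (isLeaf k a) × z ≡ leg s a 0)
  nbr-tr (inj₁ (s-tree s i a v)) = inj₂ (inj₂ (inj₁ (i , v , refl)))
  nbr-tr (inj₁ (s-leaf s a l)) = inj₂ (inj₂ (inj₂ (l , refl)))
  nbr-tr (inj₂ (s-root s)) = inj₁ (refl , refl)
  nbr-tr (inj₂ (s-tree s i a v)) = inj₂ (inj₁ (i , a , refl , refl , v))

  LegNbr : Side → List ℕ → ℕ → Vtx → Set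
  LegNbr s a j z =
    (j ≡ 0 × z ≡ tr s a) ⊎
    (Σ ℕ λ j' → j ≡ suc j' × z ≡ leg s a j') ⊎
    (suc j < c ∸ 1 × z ≡ leg s a (suc j)) ⊎
    (j ≡ cLast × Σ (T (isLeaf k a)) λ p → z ≡ av (Inverse.to σ ((s , a) , p)))

  nbr-leg : ∀ {s a j z} → Adj (leg s a j) z → LegNbr s a j z
  nbr-leg (inj₁ (s-leg s a j l lt)) = inj₂ (inj₂ (inj₁ (lt , refl)))
  nbr-leg (inj₁ (s-legA s a p)) = inj₂ (inj₂ (inj₂ (refl , p , refl)))
  nbr-leg (inj₂ (s-leaf s a l)) = inj₁ (refl , refl)
  nbr-leg (inj₂ (s-leg s a j l lt)) = inj₂ (inj₁ (j , refl , refl))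

  nbr-av : ∀ {x z} → Adj (av x) z →
    (Σ (Fin N) λ y → T (adj x y) × toℕ x < toℕ y × z ≡ ev x y 0) ⊎
    (Σ (Fin N) λ y → T (adj y x) × toℕ y < toℕ x × z ≡ ev y x cLast) ⊎
    (Σ Side λ s → Σ (List ℕ) λ a → Σ (T (isLeaf k a)) λ p →
       x ≡ Inverse.to σ ((s , a) , p) × z ≡ leg s a cLast)
  nbr-av (inj₁ (s-a x y e lt)) = inj₁ (y , e , lt , refl)
  nbr-av (inj₂ (s-legA s a p)) = inj₂ (inj₂ (s , a , p , refl , refl))
  nbr-av (inj₂ (s-eA x y e lt)) = inj₂ (inj₁ (x , e , lt , refl))

  EdgeNbr : Fin N → Fin N → ℕ → Vtx → Set
  EdgeNbr x y j z = (suc j < c ∸ 1 × z ≡ ev x y (suc j)) ⊎ (j ≡ cLast × z ≡ av y) ⊎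
    (Σ ℕ λ j' → j ≡ suc j' × z ≡ ev x y j') ⊎ (j ≡ 0 × z ≡ av x)

  nbr-ev : ∀ {x y j z} → Adj (ev x y j) z → EdgeNbr x y j z
  nbr-ev (inj₁ (s-e x y j e lt lt')) = inj₁ (lt' , refl)
  nbr-ev (inj₁ (s-eA x y e lt)) = inj₂ (inj₁ (refl , refl))
  nbr-ev (inj₂ (s-a x y e lt)) = inj₂ (inj₂ (inj₂ (refl , refl)))
  nbr-ev (inj₂ (s-e x y j e lt lt')) = inj₂ (inj₂ (inj₁ (j , refl , refl)))

module Segments {N : ℕ} where

  prependBlock : Cls → List (Cls × ℕ) → List (Cls × ℕ)
  prependBlock d [] = (d , 1) ∷ []
  prependBlock d ((d' , n) ∷ rest) =
    if d ==ᶜ d' then (d' , suc n) ∷ rest else (d , 1) ∷ (d' , n) ∷ rest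

  blocks-∷ : ∀ (w : V N) Q → blocks (w ∷ Q) ≡ prependBlock (cls w) (blocks Q)
  blocks-∷ w Q with blocks Q
  ... | [] = refl
  ... | (d , n) ∷ rest = refl

  ==ᶜ-sound : ∀ d d' → T (d ==ᶜ d') → d ≡ d'
  ==ᶜ-sound cT cT _ = refl
  ==ᶜ-sound cC cC _ = refl
  ==ᶜ-sound cX cX _ = refl

  ==ᶜ-refl : ∀ d → d ==ᶜ d ≡ true
  ==ᶜ-refl cT = refl
  ==ᶜ-refl cC = refl
  ==ᶜ-refl cX = refl

  ==ᶜ-≢ : ∀ d d' → d ≢ d' → d ==ᶜ d' ≡ false
  ==ᶜ-≢ cT cT ne = ⊥-elim (ne refl)
  ==ᶜ-≢ cC cC ne = ⊥-elim (ne refl)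
  ==ᶜ-≢ cX cX ne = ⊥-elim (ne refl)
  ==ᶜ-≢ cT cC ne = refl
  ==ᶜ-≢ cT cX ne = refl
  ==ᶜ-≢ cC cT ne = refl
  ==ᶜ-≢ cC cX ne = refl
  ==ᶜ-≢ cX cT ne = refl
  ==ᶜ-≢ cX cC ne = refl

  blocks-head : ∀ (x : V N) Q → Σ ℕ λ n → Σ (List (Cls × ℕ)) λ rest → blocks (x ∷ Q) ≡ (cls x , suc n) ∷ rest
  blocks-head x Q with blocks Q | blocks-∷ x Q
  ... | [] | eq = 0 , [] , eq
  ... | (d' , n) ∷ rest | eq with cls x ==ᶜ d' in same
  ...   | true = n , rest , trans eq (cong (λ z → (z , suc n) ∷ rest) (sym (==ᶜ-sound (cls x) d' (subst T (sym same) tt))))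
  ...   | false = 0 , (d' , n) ∷ rest , eq

  seg : List (V N) → List (Cls × ℕ)
  seg Rs = segments (blocks Rs)

  segments-∷ : ∀ d n bs → d ≢ cC → segments ((d , n) ∷ bs) ≡ (d , n ∸ 1) ∷ segments bs
  segments-∷ cT n bs _ = refl
  segments-∷ cX n bs _ = refl
  segments-∷ cC n bs ne = ⊥-elim (ne refl)

  seg-connector : ∀ (w x : V N) Q → cls w ≡ cC → seg (w ∷ x ∷ Q) ≡ seg (x ∷ Q)
  seg-connector w x Q e = trans (cong segments (blocks-∷ w (x ∷ Q))) (drop (cls w) (blocks (x ∷ Q)) e)
    where
    drop : ∀ d bs → d ≡ cC → segments (prependBlock d bs) ≡ segments bs
    drop .cC [] refl = refl
    drop .cC ((cC , n) ∷ rest) refl = refl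
    drop .cC ((cT , n) ∷ rest) refl = refl
    drop .cC ((cX , n) ∷ rest) refl = refl

  seg-head : ∀ (x : V N) Q → cls x ≢ cC → Σ ℕ λ n → Σ (List (Cls × ℕ)) λ rest → seg (x ∷ Q) ≡ (cls x , n) ∷ rest
  seg-head x Q ne with blocks-head x Q
  ... | n , rest , eq = n , segments rest , trans (cong segments eq) (segments-∷ (cls x) (suc n) rest ne)

  seg-same : ∀ (w x : V N) Q → cls w ≢ cC → cls x ≡ cls w →
    Σ ℕ λ n → Σ (List (Cls × ℕ)) λ rest →
      seg (x ∷ Q) ≡ (cls w , n) ∷ rest × seg (w ∷ x ∷ Q) ≡ (cls w , suc n) ∷ rest
  seg-same w x Q ne e with blocks-head x Q
  ... | n , rest , eq = n , segments rest ,
        trans (cong segments eq) (trans (segments-∷ (cls x) (suc n) rest (λ z → ne (trans (sym e) z)))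
                                        (cong (λ d → (d , n) ∷ segments rest) e)) ,
        trans (cong segments (trans (blocks-∷ w (x ∷ Q)) (cong (prependBlock (cls w)) eq))) (grow (cls w) (cls x) e ne)
    where
    grow : ∀ d d' → d' ≡ d → d ≢ cC → segments (prependBlock d ((d' , suc n) ∷ rest)) ≡ (d , suc n) ∷ segments rest
    grow d .d refl ne' rewrite ==ᶜ-refl d = segments-∷ d (suc (suc n)) rest ne'

  seg-diff : ∀ (w x : V N) Q → cls w ≢ cC → cls x ≢ cls w → seg (w ∷ x ∷ Q) ≡ (cls w , 0) ∷ seg (x ∷ Q)
  seg-diff w x Q ne ne' with blocks-head x Q
  ... | n , rest , eq =
    trans (cong segments (trans (blocks-∷ w (x ∷ Q)) (cong (prependBlock (cls w)) eq)))
          (trans (open' (cls w) (cls x) (λ z → ne' (sym z)) ne) (cong (λ z → (cls w , 0) ∷ segments z) (sym eq)))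
    where
    open' : ∀ d d' → d ≢ d' → d ≢ cC → segments (prependBlock d ((d' , suc n) ∷ rest)) ≡ (d , 0) ∷ segments ((d' , suc n) ∷ rest)
    open' d d' ne1 ne2 rewrite ==ᶜ-≢ d d' ne1 = segments-∷ d 1 _ ne2

  seg-same⁻ : ∀ (w x : V N) Q d t S0 → cls w ≢ cC → cls x ≡ cls w → cls w ≡ d →
              seg (w ∷ x ∷ Q) ≡ (d , t) ∷ S0 → Σ ℕ λ t' → t ≡ suc t' × seg (x ∷ Q) ≡ (d , t') ∷ S0
  seg-same⁻ w x Q d t S0 ne e1 e2 sg with seg-same w x Q ne e1
  ... | n , rest , s1 , s2 with trans (sym s2) sg
  ... | refl = n , refl , trans s1 (cong (λ z → (z , n) ∷ rest) e2)

  seg-diff⁻ : ∀ (w x : V N) Q d t S0 → cls w ≢ cC → cls x ≢ cls w →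
              seg (w ∷ x ∷ Q) ≡ (d , t) ∷ S0 → t ≡ 0 × seg (x ∷ Q) ≡ S0
  seg-diff⁻ w x Q d t S0 ne ne' sg with trans (sym (seg-diff w x Q ne ne')) sg
  ... | refl = refl , refl

  seg-same-not0 : ∀ (w x : V N) Q d S0 → cls w ≢ cC → cls x ≡ cls w → cls w ≡ d →
                  seg (w ∷ x ∷ Q) ≢ (d , 0) ∷ S0
  seg-same-not0 w x Q d S0 ne e1 e2 sg with seg-same⁻ w x Q d 0 S0 ne e1 e2 sg
  ... | _ , () , _

  seg-diff-notSuc : ∀ (w x : V N) Q d t S0 → cls w ≢ cC → cls x ≢ cls w →
                    seg (w ∷ x ∷ Q) ≢ (d , suc t) ∷ S0
  seg-diff-notSuc w x Q d t S0 ne ne' sg with seg-diff⁻ w x Q d (suc t) S0 ne ne' sg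
  ... | () , _

  seg-wrongClass : ∀ (w : V N) Q S → cls w ≢ cC → seg (w ∷ Q) ≡ S → (∀ n rest → S ≢ (cls w , n) ∷ rest) → ⊥
  seg-wrongClass w Q S ne sg f with seg-head w Q ne
  ... | n , rest , eq = f n rest (trans (sym sg) eq)

module Counting (k m' : ℕ) (adj : Fin (nA k) → Fin (nA k) → Bool) (cubic : IsCubic adj)
                (σ : Leaf k ↔ Fin (nA k)) where

  open Neighbourhoods k m' adj σ public
  open Segments {N} public
  open LeafCounts k public
  open Equivalence using (to; from)

  instance
    c-nonZero : NonZero c
    c-nonZero = subst NonZero (sym c≡) _

  IsLeafV : Vtx → Set
  IsLeafV (tr s a) = T (isLeaf k a)
  IsLeafV _ = ⊥

  EndsAtLeaf : List Vtx → Set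
  EndsAtLeaf [] = ⊥
  EndsAtLeaf (v ∷ []) = IsLeafV v
  EndsAtLeaf (v ∷ x ∷ xs) = EndsAtLeaf (x ∷ xs)

  UniqueAfter : Maybe Vtx → List Vtx → Set
  UniqueAfter nothing Rs = Unique Rs
  UniqueAfter (just p) Rs = Unique (p ∷ Rs)

  -- Rs is the remainder, from the current vertex on, of a path of 𝒫 with previous vertex
  -- prev, and S is the list of segments still to be traversed
  record Remainder (prev : Maybe Vtx) (Rs : List Vtx) (S : List (Cls × ℕ)) : Set where
    constructor remainder
    field
      linked : Linked Adj Rs
      unique : UniqueAfter prev Rs
      avoidsStar : star ∉ Rs
      endsAtLeaf : EndsAtLeaf Rs
      segs : seg Rs ≡ S

  Cont : ℕ → Maybe Vtx → Vtx → List (Cls × ℕ) → List Vtx → Set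
  Cont n prev w S Q = length Q ≤ n × Remainder prev (w ∷ Q) S

  remainder-tail : ∀ {prev w x Q S S'} → Remainder prev (w ∷ x ∷ Q) S → seg (x ∷ Q) ≡ S' →
                   Remainder (just w) (x ∷ Q) S'
  remainder-tail {nothing} (remainder (_ ∷ lk) un ns el _) e = remainder lk un (λ z → ns (there z)) el e
  remainder-tail {just p} (remainder (_ ∷ lk) (_ ∷ un) ns el _) e = remainder lk un (λ z → ns (there z)) el e

  next-adj : ∀ {prev w x Q S} → Remainder prev (w ∷ x ∷ Q) S → Adj w x
  next-adj (remainder (a ∷ _) _ _ _ _) = a

  next-≢prev : ∀ {p w x Q S} → Remainder (just p) (w ∷ x ∷ Q) S → p ≢ x
  next-≢prev (remainder _ ((_ ∷ ne ∷ _) ∷ _) _ _ _) = ne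

  next-≢prev' : ∀ {prev p w x Q S} → prev ≡ just p → Remainder prev (w ∷ x ∷ Q) S → p ≢ x
  next-≢prev' refl g = next-≢prev g

  next-≢star : ∀ {prev w x Q S} → Remainder prev (w ∷ x ∷ Q) S → x ≢ star
  next-≢star (remainder _ _ ns _ _) e = ns (there (here (sym e)))

  -- modes of a walk, remembering what is needed to know its possible next steps
  data Mode : Set where
    ascend descend : ℕ → Mode   -- in a tree at the given height, going up / down
    toA toTree : Mode            -- on a connecting path, towards A / towards a tree
    entered : Mode               -- at a vertex of A, just arrived from a connecting path
    inA : Mode                   -- at a vertex of A, just arrived along an edge of A
    onEdge : ℕ → Mode            -- inside a subdivided edge, with the given steps left

  -- position i (0 … cLast) on the path replacing the edge xy, counted from x
  pos : Fin N → Fin N → ℕ → Vtx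
  pos x y i = if toℕ x <ᵇ toℕ y then ev x y i else ev y x (cLast ∸ i)

  prevOnEdge : Fin N → Fin N → ℕ → Vtx
  prevOnEdge x y zero = av x
  prevOnEdge x y (suc i) = pos x y i

  prevOnLeg : Side → List ℕ → ℕ → Vtx
  prevOnLeg s a zero = tr s a
  prevOnLeg s a (suc j) = leg s a j

  legOf : Fin N → Vtx
  legOf x = leg (proj₁ (proj₁ (Inverse.from σ x))) (proj₂ (proj₁ (Inverse.from σ x))) cLast

  ArrivedFromA : Maybe Vtx → (s : Side) (a : List ℕ) → ℕ → T (isLeaf k a) → Set
  ArrivedFromA prev s a j p =
    (j ≡ cLast × prev ≡ just (av (Inverse.to σ ((s , a) , p)))) ⊎ (suc j ≤ cLast × prev ≡ just (leg s a (suc j)))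

  Inv : Mode → Maybe Vtx → Vtx → Set
  Inv (ascend e) prev w = Σ Side λ s → Σ (List ℕ) λ a → w ≡ tr s a × T (validT k a) × e + length a ≡ 2 * k
  Inv (descend e) prev w = Σ Side λ s → Σ (List ℕ) λ a' → Σ ℕ λ i →
    w ≡ tr s (i ∷ a') × prev ≡ just (tr s a') × T (validT k (i ∷ a')) × e + suc (length a') ≡ 2 * k
  Inv toA prev w = Σ Side λ s → Σ (List ℕ) λ a → Σ ℕ λ j →
    w ≡ leg s a j × T (isLeaf k a) × j ≤ cLast × prev ≡ just (prevOnLeg s a j)
  Inv toTree prev w = Σ Side λ s → Σ (List ℕ) λ a → Σ ℕ λ j → Σ (T (isLeaf k a)) λ p →
    w ≡ leg s a j × j ≤ cLast × ArrivedFromA prev s a j p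
  Inv entered prev w = Σ (Fin N) λ x → w ≡ av x
  Inv inA prev w = Σ (Fin N) λ x → Σ (Fin N) λ y → w ≡ av x × T (adj x y) × prev ≡ just (pos x y 0)
  Inv (onEdge jr) prev w = Σ (Fin N) λ x → Σ (Fin N) λ y → Σ ℕ λ i →
    w ≡ pos x y i × T (adj x y) × i ≤ cLast × jr ≡ suc (cLast ∸ i) × prev ≡ just (prevOnEdge x y i)

  Φ : List (Cls × ℕ) → ℕ
  Φ [] = 1
  Φ ((cT , t) ∷ S) = lam k ⌊ t /2⌋ * Φ S
  Φ ((cX , t) ∷ S) = 3 * 2 ^ (t / c) * Φ S
  Φ ((cC , t) ∷ S) = 0

  -- the same, but 0 when nothing is left (used when the walk must go on)
  Φ⁺ : List (Cls × ℕ) → ℕ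
  Φ⁺ [] = 0
  Φ⁺ (x ∷ S) = Φ (x ∷ S)

  -- 1 when nothing is left (used when the walk may stop)
  done : List (Cls × ℕ) → ℕ
  done [] = 1
  done (_ ∷ _) = 0

  Φ⁺+done : ∀ S → Φ⁺ S + done S ≤ Φ S
  Φ⁺+done [] = ≤-refl
  Φ⁺+done (x ∷ S) = ≤-reflexive (+-identityʳ _)

  Φ⁺≤Φ : ∀ S → Φ⁺ S ≤ Φ S
  Φ⁺≤Φ [] = z≤n
  Φ⁺≤Φ (x ∷ S) = ≤-refl

  -- on a subdivided edge with jr steps to go, inside an expander segment of t steps
  edgePot : ℕ → ℕ → ℕ → ℕ
  edgePot jr t φ = if jr ≤ᵇ t then 2 * 2 ^ ((t ∸ jr) / c) * φ else 0

  pot : Mode → List (Cls × ℕ) → ℕ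
  pot (ascend e) ((cT , t) ∷ S) = ascendPot e t (Φ S)
  pot (descend e) ((cT , t) ∷ S) = descendPot e t (Φ S)
  pot toA S = Φ⁺ S
  pot toTree S = Φ⁺ S
  pot entered S = Φ⁺ S
  pot inA ((cX , t) ∷ S) = 2 * 2 ^ (t / c) * Φ S
  pot (onEdge jr) ((cX , t) ∷ S) = edgePot jr t (Φ S)
  pot _ _ = 0

  W : List (Cls × ℕ) → ℕ
  W S = 2 ^ countX S

  Bounded : ℕ → Set
  Bounded n = ∀ md prev w S → Inv md prev w → ∀ Qs → Unique Qs → All (Cont n prev w S) Qs →
              W S * length Qs ≤ pot md S

  BoundedBelow : ℕ → Set
  BoundedBelow n = ∀ n' → n ≡ suc n' → Bounded n'

  none : ∀ {P : List Vtx → Set} (w b : ℕ) Qs → All P Qs → (∀ Q → ¬ P Q) → w * length Qs ≤ b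
  none w b [] _ _ = subst (_≤ b) (sym (*-zeroʳ w)) z≤n
  none w b (Q ∷ Qs) (p ∷ _) f = ⊥-elim (f Q p)

  -- Continuations through the next vertex x are continuations from x in mode md' with
  -- segments S', so the induction hypothesis bounds them (the weight changing by K).
  advance : ∀ n → BoundedBelow n → ∀ {prev w S x} md' S' (K b : ℕ) →
            W S ≡ K * W S' → K * pot md' S' ≤ b →
            (∀ Q → Cont n prev w S (x ∷ Q) → Inv md' (just w) x × seg (x ∷ Q) ≡ S') →
            ∀ Qs → Unique Qs → All (λ Q → Cont n prev w S (x ∷ Q)) Qs → W S * length Qs ≤ b
  advance n ih {S = S} md' S' K b eW le f [] _ _ = subst (_≤ b) (sym (*-zeroʳ (W S))) z≤n
  advance zero ih md' S' K b eW le f (Q ∷ Qs) _ ((() , _) ∷ _)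
  advance (suc n') ih {prev} {w} {S} {x} md' S' K b eW le f (Q ∷ Qs) uQ aQ@(p0 ∷ _) = begin
      W S * length (Q ∷ Qs)  ≡⟨ cong (_* length (Q ∷ Qs)) eW ⟩
      K * W S' * length (Q ∷ Qs) ≡⟨ *-assoc K _ _ ⟩
      K * (W S' * length (Q ∷ Qs)) ≤⟨ *-monoʳ-≤ K step ⟩
      K * pot md' S' ≤⟨ le ⟩
      b ∎
    where
    open ≤-Reasoning
    shift : ∀ {Q'} → Cont (suc n') prev w S (x ∷ Q') → Cont n' (just w) x S' Q'
    shift {Q'} (s≤s l , g) = l , remainder-tail g (proj₂ (f Q' (s≤s l , g)))
    step = ih n' refl md' (just w) x S' (proj₁ (f Q p0)) (Q ∷ Qs) uQ (All.map shift aQ)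

  advance1 : ∀ n → BoundedBelow n → ∀ {prev w S x} md' S' →
             W S ≡ W S' →
             (∀ Q → Cont n prev w S (x ∷ Q) → Inv md' (just w) x × seg (x ∷ Q) ≡ S') →
             ∀ Qs → Unique Qs → All (λ Q → Cont n prev w S (x ∷ Q)) Qs → W S * length Qs ≤ pot md' S'
  advance1 n ih md' S' eW =
    advance n ih md' S' 1 _ (trans eW (sym (*-identityˡ _))) (≤-reflexive (*-identityˡ _))

  past-connector : ∀ {n prev w S} x Q → cls w ≡ cC → Cont n prev w S (x ∷ Q) → seg (x ∷ Q) ≡ S
  past-connector x Q e (_ , g) = trans (sym (seg-connector _ x Q e)) (Remainder.segs g)

  wrongClass : ∀ {n prev} (w : Vtx) S b → cls w ≢ cC → (∀ n rest → S ≢ (cls w , n) ∷ rest) →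
               ∀ Qs → All (Cont n prev w S) Qs → W S * length Qs ≤ b
  wrongClass w S b ne f Qs aQ = none (W S) b Qs aQ (λ Q (_ , g) → seg-wrongClass w Q S ne (Remainder.segs g) f)

  sum-++ : ∀ (xs ys : List (Vtx × ℕ)) → sum (map proj₂ (xs ++ ys)) ≡ sum (map proj₂ xs) + sum (map proj₂ ys)
  sum-++ [] ys = refl
  sum-++ ((_ , b) ∷ xs) ys = trans (cong (b +_) (sum-++ xs ys)) (sym (+-assoc b _ _))

  sum-const : ∀ {B : Set} (f : B → Vtx) (b : ℕ) (xs : List B) → sum (map proj₂ (map (λ i → (f i , b)) xs)) ≡ length xs * b
  sum-const f b [] = refl
  sum-const f b (x ∷ xs) = cong (b +_) (sum-const f b xs)

  -- Tree modes: a tree segment is a walk up to some height and straight down to a leaf.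

  valid-∷ : ∀ {i a} → T (validT k (i ∷ a)) → (length a < 2 * k) × (i < branch k (length a)) × T (validT k a)
  valid-∷ {i} {a} v with to T-∧ v
  ... | v1 , v23 with to T-∧ v23
  ... | v2 , v3 = <ᵇ⇒< _ _ v1 , <ᵇ⇒< _ _ v2 , v3

  leaf-valid : ∀ {a} → T (isLeaf k a) → T (validT k a) × length a ≡ 2 * k
  leaf-valid {a} l with to T-∧ l
  ... | v , e = v , ≡ᵇ⇒≡ _ _ e

  2+n≢n : ∀ n → suc (suc n) ≢ n
  2+n≢n (suc n) eq = 2+n≢n n (suc-injective eq)

  height0 : ∀ e n → e + n ≡ n → e ≡ 0
  height0 e n eq = +-cancelʳ-≡ n e 0 eq

  child-valid : ∀ {s a i} → Adj (tr s a) (tr s (i ∷ a)) → T (validT k (i ∷ a))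
  child-valid {s} {a} {i} ad with nbr-tr ad
  ... | inj₁ (_ , ())
  ... | inj₂ (inj₁ (i' , a'' , refl , eq , _)) = ⊥-elim (2+n≢n (length a'') (cong depth eq))
    where
    depth : Vtx → ℕ
    depth (tr _ l) = length l
    depth _ = 0
  ... | inj₂ (inj₂ (inj₁ (i' , v , refl))) = v
  ... | inj₂ (inj₂ (inj₂ (_ , ())))

  leg-at-leaf : ∀ {s a s' a' j} → Adj (tr s a) (leg s' a' j) → T (isLeaf k a)
  leg-at-leaf ad with nbr-tr ad
  ... | inj₁ (_ , ())
  ... | inj₂ (inj₁ (_ , _ , _ , () , _))
  ... | inj₂ (inj₂ (inj₁ (_ , _ , ())))
  ... | inj₂ (inj₂ (inj₂ (l , _))) = l

  parentCand : Side → List ℕ → ℕ → List (Vtx × ℕ)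
  parentCand s [] b = []
  parentCand s (i ∷ a') b = (tr s a' , b) ∷ []

  childCands : Side → List ℕ → ℕ → List (Vtx × ℕ)
  childCands s a b = map (λ i → (tr s (i ∷ a) , b)) (upTo (branch k (length a)))

  legCand : Side → List ℕ → ℕ → List (Vtx × ℕ)
  legCand s a b = (leg s a 0 , b) ∷ []

  sum-parentCand : ∀ s a b → sum (map proj₂ (parentCand s a b)) ≤ b
  sum-parentCand s [] b = z≤n
  sum-parentCand s (i ∷ a) b = ≤-reflexive (+-identityʳ b)

  sum-childCands : ∀ s a b → sum (map proj₂ (childCands s a b)) ≡ branch k (length a) * b
  sum-childCands s a b = trans (sum-const (λ i → tr s (i ∷ a)) b (upTo (branch k (length a))))
                               (cong (_* b) (ListP.length-upTo (branch k (length a))))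

  module TreeSteps (n : ℕ) (ih : BoundedBelow n) (prev : Maybe Vtx) (s : Side) (a : List ℕ)
                   (S0 : List (Cls × ℕ)) (va : T (validT k a)) where

    w : Vtx
    w = tr s a

    S : ℕ → List (Cls × ℕ)
    S t = (cT , t) ∷ S0

    notC : cls w ≢ cC
    notC ()

    viaParent : ∀ e t → e + length a ≡ 2 * k → ∀ i a' → a ≡ i ∷ a' →
                ∀ Qs → Unique Qs → All (λ Q → Cont n prev w (S t) (tr s a' ∷ Q)) Qs →
                W (S t) * length Qs ≤ toParent e t (Φ S0)
    viaParent e zero he i a' refl Qs uQ aQ =
      none (W S0) _ Qs aQ (λ Q (_ , g) → seg-same-not0 w (tr s a') Q cT S0 notC refl refl (Remainder.segs g))
    viaParent e (suc t') he i a' refl Qs uQ aQ = advance1 n ih (ascend (suc e)) ((cT , t') ∷ S0) refl up Qs uQ aQ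
      where
      up : ∀ Q → Cont n prev w ((cT , suc t') ∷ S0) (tr s a' ∷ Q) →
           Inv (ascend (suc e)) (just w) (tr s a') × seg (tr s a' ∷ Q) ≡ (cT , t') ∷ S0
      up Q (_ , g) with seg-same⁻ w (tr s a') Q cT (suc t') S0 notC refl refl (Remainder.segs g)
      ... | _ , refl , sq = (s , a' , refl , proj₂ (proj₂ (valid-∷ {i} {a'} va)) , trans (sym (+-suc e (length a'))) he) , sq

    viaChild : ∀ e t → e + length a ≡ 2 * k → ∀ i →
               ∀ Qs → Unique Qs → All (λ Q → Cont n prev w (S t) (tr s (i ∷ a) ∷ Q)) Qs →
               W (S t) * length Qs ≤ toChild e t (Φ S0)
    viaChild zero t he i Qs uQ aQ = none (W S0) _ Qs aQ (λ Q (_ , g) →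
      <-irrefl refl (<-≤-trans (proj₁ (valid-∷ {i} {a} (child-valid {s} {a} {i} (next-adj g)))) (≤-reflexive (sym he))))
    viaChild (suc e') zero he i Qs uQ aQ =
      none (W S0) _ Qs aQ (λ Q (_ , g) → seg-same-not0 w (tr s (i ∷ a)) Q cT S0 notC refl refl (Remainder.segs g))
    viaChild (suc e') (suc t') he i Qs uQ aQ = advance1 n ih (descend e') ((cT , t') ∷ S0) refl down Qs uQ aQ
      where
      down : ∀ Q → Cont n prev w ((cT , suc t') ∷ S0) (tr s (i ∷ a) ∷ Q) →
             Inv (descend e') (just w) (tr s (i ∷ a)) × seg (tr s (i ∷ a) ∷ Q) ≡ (cT , t') ∷ S0
      down Q (_ , g) with seg-same⁻ w (tr s (i ∷ a)) Q cT (suc t') S0 notC refl refl (Remainder.segs g)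
      ... | _ , refl , sq = (s , a , i , refl , refl , child-valid {s} {a} {i} (next-adj g) , trans (+-suc e' (length a)) he) , sq

    viaLeg : ∀ e t → e + length a ≡ 2 * k →
             ∀ Qs → Unique Qs → All (λ Q → Cont n prev w (S t) (leg s a 0 ∷ Q)) Qs →
             W (S t) * length Qs ≤ toLeg e t (Φ⁺ S0)
    viaLeg e (suc t') he Qs uQ aQ =
      none (W S0) _ Qs aQ (λ Q (_ , g) → seg-diff-notSuc w (leg s a 0) Q cT t' S0 notC (λ ()) (Remainder.segs g))
    viaLeg (suc e') zero he Qs uQ aQ = none (W S0) _ Qs aQ (λ Q (_ , g) →
      case height0 (suc e') (length a) (trans he (sym (proj₂ (leaf-valid {a} (leg-at-leaf {s} {a} (next-adj g)))))) of λ ())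
    viaLeg zero zero he Qs uQ aQ = advance1 n ih toA S0 refl out Qs uQ aQ
      where
      out : ∀ Q → Cont n prev w ((cT , 0) ∷ S0) (leg s a 0 ∷ Q) → Inv toA (just w) (leg s a 0) × seg (leg s a 0 ∷ Q) ≡ S0
      out Q (_ , g) = (s , a , 0 , refl , leg-at-leaf {s} {a} (next-adj g) , z≤n , refl) ,
                      proj₂ (seg-diff⁻ w (leg s a 0) Q cT 0 S0 notC (λ ()) (Remainder.segs g))

    stop : ∀ e t → e + length a ≡ 2 * k → Cont n prev w (S t) [] → W S0 ≤ stopHere e t (done S0)
    stop e t he (_ , remainder _ _ _ el sg) with sg | height0 e (length a) (trans he (sym (proj₂ (leaf-valid {a} el))))
    ... | refl | refl = ≤-refl

  count-ascend : ∀ n → BoundedBelow n → ∀ e prev w S → Inv (ascend e) prev w → ∀ Qs → Unique Qs →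
                 All (Cont n prev w S) Qs → W S * length Qs ≤ pot (ascend e) S
  count-ascend n ih e prev .(tr s a) [] (s , a , refl , va , he) Qs uQ aQ =
    wrongClass (tr s a) [] 0 (λ ()) (λ _ _ ()) Qs aQ
  count-ascend n ih e prev .(tr s a) ((cC , t) ∷ S0) (s , a , refl , va , he) Qs uQ aQ =
    wrongClass (tr s a) _ 0 (λ ()) (λ _ _ ()) Qs aQ
  count-ascend n ih e prev .(tr s a) ((cX , t) ∷ S0) (s , a , refl , va , he) Qs uQ aQ =
    wrongClass (tr s a) _ 0 (λ ()) (λ _ _ ()) Qs aQ
  count-ascend n ih e prev .(tr s a) ((cT , t) ∷ S0) (s , a , refl , va , he) Qs uQ aQ =
    ≤-trans (CountByHead.countByHead _≟V_ (W S0) (stopHere e t (done S0)) cands Qs uQ aQ (stop e t he) covered bounded)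
      (≤-trans (+-monoʳ-≤ (stopHere e t (done S0)) total)
        (ascend-step e t (Φ S0) (Φ⁺ S0) (done S0) br (Φ⁺+done S0) branching))
    where
    open TreeSteps n ih prev s a S0 va
    br = branch k (length a)
    bp = toParent e t (Φ S0)
    bc = toChild e t (Φ S0)
    bl = toLeg e t (Φ⁺ S0)
    cands = parentCand s a bp ++ (childCands s a bc ++ legCand s a bl)
    total : sum (map proj₂ cands) ≤ bp + (br * bc + (bl + 0))
    total = ≤-trans (≤-reflexive (trans (sum-++ (parentCand s a bp) _) (cong (sum (map proj₂ (parentCand s a bp)) +_) (sum-++ (childCands s a bc) _))))
              (+-mono-≤ (sum-parentCand s a bp) (≤-reflexive (cong (_+ (bl + 0)) (sum-childCands s a bc))))
    branching : ∀ e' → e ≡ suc e' → br * lam k e' ≤ lam k (suc e')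
    branching e' refl = ≤-reflexive (branch*lam (length a) e' he)
    covered : ∀ {y Q} → Cont n prev (tr s a) ((cT , t) ∷ S0) (y ∷ Q) → Σ ℕ λ b → (y , b) ∈ cands
    covered (_ , g) with nbr-tr (next-adj g)
    ... | inj₁ (_ , refl) = ⊥-elim (next-≢star g refl)
    ... | inj₂ (inj₁ (i , a' , refl , refl , _)) = bp , here refl
    ... | inj₂ (inj₂ (inj₁ (i , v , refl))) =
      bc , ∈-++⁺ʳ (parentCand s a bp) (∈-++⁺ˡ (∈-map⁺ (λ i → (tr s (i ∷ a) , bc)) (∈-upTo⁺ (proj₁ (proj₂ (valid-∷ {i} {a} v))))))
    ... | inj₂ (inj₂ (inj₂ (l , refl))) = bl , ∈-++⁺ʳ (parentCand s a bp) (∈-++⁺ʳ (childCands s a bc) (here refl))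
    bounded : ∀ {y b} → (y , b) ∈ cands → ∀ Qs → Unique Qs → All (λ Q → Cont n prev (tr s a) ((cT , t) ∷ S0) (y ∷ Q)) Qs →
              W S0 * length Qs ≤ b
    bounded {y} {b} mem Qs uQ aQ with ∈-++⁻ (parentCand s a bp) mem
    ... | inj₁ m1 = parent a m1 refl
      where
      parent : ∀ a0 → (y , b) ∈ parentCand s a0 bp → a ≡ a0 → W S0 * length Qs ≤ b
      parent (i ∷ a') (here refl) eq = viaParent e t he i a' eq Qs uQ aQ
    ... | inj₂ m2 with ∈-++⁻ (childCands s a bc) m2
    ...   | inj₁ m3 with ∈-map⁻ (λ i → (tr s (i ∷ a) , bc)) m3
    ...     | i , _ , refl = viaChild e t he i Qs uQ aQ
    bounded mem Qs uQ aQ | inj₂ _ | inj₂ (here refl) = viaLeg e t he Qs uQ aQ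

  count-descend : ∀ n → BoundedBelow n → ∀ e prev w S → Inv (descend e) prev w → ∀ Qs → Unique Qs →
                  All (Cont n prev w S) Qs → W S * length Qs ≤ pot (descend e) S
  count-descend n ih e .(just (tr s a')) .(tr s (i ∷ a')) [] (s , a' , i , refl , refl , va , he) Qs uQ aQ =
    wrongClass (tr s (i ∷ a')) [] 0 (λ ()) (λ _ _ ()) Qs aQ
  count-descend n ih e .(just (tr s a')) .(tr s (i ∷ a')) ((cC , t) ∷ S0) (s , a' , i , refl , refl , va , he) Qs uQ aQ =
    wrongClass (tr s (i ∷ a')) _ 0 (λ ()) (λ _ _ ()) Qs aQ
  count-descend n ih e .(just (tr s a')) .(tr s (i ∷ a')) ((cX , t) ∷ S0) (s , a' , i , refl , refl , va , he) Qs uQ aQ =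
    wrongClass (tr s (i ∷ a')) _ 0 (λ ()) (λ _ _ ()) Qs aQ
  count-descend n ih e .(just (tr s a')) .(tr s (i ∷ a')) ((cT , t) ∷ S0) (s , a' , i , refl , refl , va , he) Qs uQ aQ =
    ≤-trans (CountByHead.countByHead _≟V_ (W S0) (stopHere e t (done S0)) cands Qs uQ aQ (stop e t he) covered bounded)
      (≤-trans (+-monoʳ-≤ (stopHere e t (done S0)) total)
        (descend-step e t (Φ S0) (Φ⁺ S0) (done S0) br (Φ⁺+done S0) branching))
    where
    a = i ∷ a'
    prev = just (tr s a')
    open TreeSteps n ih prev s a S0 va
    br = branch k (length a)
    bc = toChild e t (Φ S0)
    bl = toLeg e t (Φ⁺ S0)
    cands = childCands s a bc ++ legCand s a bl
    total : sum (map proj₂ cands) ≤ br * bc + (bl + 0)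
    total = ≤-reflexive (trans (sum-++ (childCands s a bc) (legCand s a bl)) (cong (_+ (bl + 0)) (sum-childCands s a bc)))
    branching : ∀ e' → e ≡ suc e' → br * lam k e' ≤ lam k (suc e')
    branching e' refl = ≤-reflexive (branch*lam (length a) e' he)
    covered : ∀ {y Q} → Cont n prev (tr s a) ((cT , t) ∷ S0) (y ∷ Q) → Σ ℕ λ b → (y , b) ∈ cands
    covered (_ , g) with nbr-tr (next-adj g)
    ... | inj₁ (_ , refl) = ⊥-elim (next-≢star g refl)
    ... | inj₂ (inj₁ (_ , _ , refl , refl , _)) = ⊥-elim (next-≢prev g refl)
    ... | inj₂ (inj₂ (inj₁ (i , v , refl))) =
      bc , ∈-++⁺ˡ (∈-map⁺ (λ i → (tr s (i ∷ a) , bc)) (∈-upTo⁺ (proj₁ (proj₂ (valid-∷ {i} {a} v)))))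
    ... | inj₂ (inj₂ (inj₂ (l , refl))) = bl , ∈-++⁺ʳ (childCands s a bc) (here refl)
    bounded : ∀ {y b} → (y , b) ∈ cands → ∀ Qs → Unique Qs → All (λ Q → Cont n prev (tr s a) ((cT , t) ∷ S0) (y ∷ Q)) Qs →
              W S0 * length Qs ≤ b
    bounded {y} {b} mem Qs uQ aQ with ∈-++⁻ (childCands s a bc) mem
    ... | inj₁ m3 with ∈-map⁻ (λ i → (tr s (i ∷ a) , bc)) m3
    ...   | i , _ , refl = viaChild e t he i Qs uQ aQ
    bounded mem Qs uQ aQ | inj₂ (here refl) = viaLeg e t he Qs uQ aQ

  -- Connector modes: a connecting path is traversed completely, in one direction.

  leg-step : ∀ j φ → j ≤ cLast → (if suc j ≤ᵇ cLast then φ else 0) + ((if j ≡ᵇ cLast then φ else 0) + 0) ≤ φ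
  leg-step j φ j≤ with suc j ≤ᵇ cLast in e1 | j ≡ᵇ cLast in e2
  ... | true | true =
    ⊥-elim (<-irrefl refl (≤-trans (≤ᵇ⇒≤ (suc j) cLast (T-true e1)) (≤-reflexive (sym (≡ᵇ⇒≡ j cLast (T-true e2))))))
  ... | true | false = ≤-reflexive (+-identityʳ φ)
  ... | false | true = ≤-reflexive (+-identityʳ φ)
  ... | false | false = z≤n

  count-toA : ∀ n → BoundedBelow n → ∀ prev w S → Inv toA prev w → ∀ Qs → Unique Qs →
              All (Cont n prev w S) Qs → W S * length Qs ≤ pot toA S
  count-toA n ih .(just (prevOnLeg s a j)) .(leg s a j) S (s , a , j , refl , lf , j≤ , refl) Qs uQ aQ =
    ≤-trans (CountByHead.countByHead _≟V_ (W S) 0 cands Qs uQ aQ (λ { (_ , remainder _ _ _ () _) }) covered bounded)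
      (leg-step j (Φ⁺ S) j≤)
    where
    w = leg s a j
    prev = just (prevOnLeg s a j)
    x0 = Inverse.to σ ((s , a) , lf)
    bNext = if suc j ≤ᵇ cLast then Φ⁺ S else 0
    bA = if j ≡ᵇ cLast then Φ⁺ S else 0
    cands = (leg s a (suc j) , bNext) ∷ (av x0 , bA) ∷ []
    covered : ∀ {y Q} → Cont n prev w S (y ∷ Q) → Σ ℕ λ b → (y , b) ∈ cands
    covered (_ , g) with nbr-leg (next-adj g)
    ... | inj₁ (refl , refl) = ⊥-elim (next-≢prev g refl)
    ... | inj₂ (inj₁ (j' , refl , refl)) = ⊥-elim (next-≢prev g refl)
    ... | inj₂ (inj₂ (inj₁ (lt , refl))) = bNext , here refl
    ... | inj₂ (inj₂ (inj₂ (eq , p , refl))) rewrite T-irrelevant p lf = bA , there (here refl)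
    bounded : ∀ {y b} → (y , b) ∈ cands → ∀ Qs → Unique Qs → All (λ Q → Cont n prev w S (y ∷ Q)) Qs → W S * length Qs ≤ b
    bounded (here refl) Qs uQ aQ with suc j ≤ᵇ cLast in e1
    ... | false = none (W S) 0 Qs aQ (λ Q (_ , g) → blocked (nbr-leg (next-adj g)))
      where
      blocked : ¬ LegNbr s a j (leg s a (suc j))
      blocked (inj₁ (_ , ()))
      blocked (inj₂ (inj₁ (j' , refl , eq))) = 2+n≢n j' (cong (λ { (leg _ _ z) → z ; _ → 0 }) eq)
      blocked (inj₂ (inj₂ (inj₁ (lt , _)))) = T-false e1 (≤⇒≤ᵇ (c∸1-lt lt))
      blocked (inj₂ (inj₂ (inj₂ (_ , _ , ()))))
    ... | true = advance1 n ih toA S refl along Qs uQ aQ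
      where
      along : ∀ Q → Cont n prev w S (leg s a (suc j) ∷ Q) → Inv toA (just w) (leg s a (suc j)) × seg (leg s a (suc j) ∷ Q) ≡ S
      along Q c = (s , a , suc j , refl , lf , ≤ᵇ⇒≤ (suc j) cLast (T-true e1) , refl) , past-connector _ Q refl c
    bounded (there (here refl)) Qs uQ aQ with j ≡ᵇ cLast in e2
    ... | false = none (W S) 0 Qs aQ (λ Q (_ , g) → blocked (nbr-leg (next-adj g)))
      where
      blocked : ¬ LegNbr s a j (av x0)
      blocked (inj₁ (_ , ()))
      blocked (inj₂ (inj₁ (_ , _ , ())))
      blocked (inj₂ (inj₂ (inj₁ (_ , ()))))
      blocked (inj₂ (inj₂ (inj₂ (eq , _ , _)))) = T-false e2 (≡⇒≡ᵇ j cLast eq)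
    ... | true = advance1 n ih entered S refl enter Qs uQ aQ
      where
      enter : ∀ Q → Cont n prev w S (av x0 ∷ Q) → Inv entered (just w) (av x0) × seg (av x0 ∷ Q) ≡ S
      enter Q c = (x0 , refl) , past-connector _ Q refl c

  toTree-next : ∀ {n prev s a j x Q S} (p : T (isLeaf k a)) → ArrivedFromA prev s a j p →
                Cont n prev (leg s a j) S (x ∷ Q) → x ≡ prevOnLeg s a j
  toTree-next {prev = prev} {s} {a} {j} p came (_ , g) with nbr-leg (next-adj g)
  ... | inj₁ (refl , refl) = refl
  ... | inj₂ (inj₁ (j' , refl , refl)) = refl
  ... | inj₂ (inj₂ (inj₁ (lt , refl))) = ⊥-elim (notForward came)
    where
    notForward : ¬ ArrivedFromA prev s a j p
    notForward (inj₁ (eq , _)) = <-irrefl refl (≤-trans (c∸1-lt lt) (≤-reflexive (sym eq)))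
    notForward (inj₂ (_ , e)) = next-≢prev' e g refl
  ... | inj₂ (inj₂ (inj₂ (eq , p' , refl))) = ⊥-elim (notIntoA came)
    where
    notIntoA : ¬ ArrivedFromA prev s a j p
    notIntoA (inj₁ (_ , e)) = next-≢prev' e g (cong (λ q → av (Inverse.to σ ((s , a) , q))) (T-irrelevant p p'))
    notIntoA (inj₂ (le , _)) = <-irrefl refl (≤-trans le (≤-reflexive (sym eq)))

  toTree-reduce : ∀ n {prev s a j} (lf : T (isLeaf k a)) → ArrivedFromA prev s a j lf →
    ∀ S Qs → Unique Qs → All (Cont n prev (leg s a j) S) Qs →
    (∀ Qs' → Unique Qs' → All (λ Q → Cont n prev (leg s a j) S (prevOnLeg s a j ∷ Q)) Qs' → W S * length Qs' ≤ Φ⁺ S) →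
    W S * length Qs ≤ Φ⁺ S
  toTree-reduce n {prev} {s} {a} {j} lf came S Qs uQ aQ back =
    ≤-trans (CountByHead.countByHead _≟V_ (W S) 0 cands Qs uQ aQ (λ { (_ , remainder _ _ _ () _) }) covered bounded)
      (≤-reflexive (+-identityʳ _))
    where
    cands = (prevOnLeg s a j , Φ⁺ S) ∷ []
    covered : ∀ {y Q} → Cont n prev (leg s a j) S (y ∷ Q) → Σ ℕ λ b → (y , b) ∈ cands
    covered c = Φ⁺ S , here (cong (_, Φ⁺ S) (toTree-next lf came c))
    bounded : ∀ {y b} → (y , b) ∈ cands → ∀ Qs → Unique Qs → All (λ Q → Cont n prev (leg s a j) S (y ∷ Q)) Qs →
              W S * length Qs ≤ b
    bounded (here refl) = back

  count-toTree : ∀ n → BoundedBelow n → ∀ prev w S → Inv toTree prev w → ∀ Qs → Unique Qs →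
                 All (Cont n prev w S) Qs → W S * length Qs ≤ pot toTree S
  count-toTree n ih prev .(leg s a (suc j)) S (s , a , suc j , lf , refl , j≤ , came) Qs uQ aQ =
    toTree-reduce n lf came S Qs uQ aQ (advance1 n ih toTree S refl along)
    where
    along : ∀ Q → Cont n prev (leg s a (suc j)) S (leg s a j ∷ Q) → Inv toTree (just (leg s a (suc j))) (leg s a j) × seg (leg s a j ∷ Q) ≡ S
    along Q c = (s , a , j , lf , refl , ≤-trans (n≤1+n j) j≤ , inj₂ (j≤ , refl)) , past-connector _ Q refl c
  count-toTree n ih prev .(leg s a zero) S (s , a , zero , lf , refl , j≤ , came) Qs uQ aQ =
    toTree-reduce n lf came S Qs uQ aQ (intoTree S refl)
    where
    Into : List Vtx → Set
    Into = λ Q → Cont n prev (leg s a 0) S (tr s a ∷ Q)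
    intoTree : ∀ S' → S' ≡ S → ∀ Qs' → Unique Qs' → All Into Qs' → W S * length Qs' ≤ Φ⁺ S
    intoTree ((cT , t) ∷ S0) refl =
      advance n ih (ascend 0) S 1 _ (sym (*-identityˡ _))
        (≤-reflexive (trans (*-identityˡ _) (cong (λ z → lam k ⌊ z /2⌋ * Φ S0) (+-identityʳ t)))) leaf
      where
      leaf : ∀ Q → Into Q → Inv (ascend 0) (just (leg s a 0)) (tr s a) × seg (tr s a ∷ Q) ≡ S
      leaf Q c = (s , a , refl , proj₁ (leaf-valid {a} lf) , proj₂ (leaf-valid {a} lf)) , past-connector _ Q refl c
    intoTree [] refl Qs' _ aQ' = none (W S) _ Qs' aQ' (λ Q c → seg-wrongClass (tr s a) Q S (λ ()) (past-connector _ Q refl c) (λ _ _ ()))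
    intoTree ((cC , t) ∷ S0) refl Qs' _ aQ' = none (W S) _ Qs' aQ' (λ Q c → seg-wrongClass (tr s a) Q S (λ ()) (past-connector _ Q refl c) (λ _ _ ()))
    intoTree ((cX , t) ∷ S0) refl Qs' _ aQ' = none (W S) _ Qs' aQ' (λ Q c → seg-wrongClass (tr s a) Q S (λ ()) (past-connector _ Q refl c) (λ _ _ ()))

  -- Expander modes: an expander segment consists of whole subdivided edges of A.

  ∸-step : ∀ m n → n < m → m ∸ n ≡ suc (m ∸ suc n)
  ∸-step (suc m) zero _ = refl
  ∸-step (suc m) (suc n) (s≤s lt) = ∸-step m n lt

  ≤ᵇ-suc : ∀ a b → (suc a ≤ᵇ suc b) ≡ (a ≤ᵇ b)
  ≤ᵇ-suc zero b = refl
  ≤ᵇ-suc (suc a) b = refl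

  -- a full edge of A, of length c, doubles the count 2^(t/c)
  /c-step : ∀ t → c ≤ t → t / c ≡ suc ((t ∸ c) / c)
  /c-step t le = begin
    t / c ≡⟨ cong (_/ c) (sym (m∸n+n≡m le)) ⟩
    (t ∸ c + c) / c ≡⟨ +-distrib-/-∣ʳ (t ∸ c) (∣-refl {c}) ⟩
    (t ∸ c) / c + c / c ≡⟨ cong ((t ∸ c) / c +_) (n/n≡1 c) ⟩
    (t ∸ c) / c + 1 ≡⟨ +-comm _ 1 ⟩
    suc ((t ∸ c) / c) ∎
    where open ≡-Reasoning

  intoEdge : ℕ → ℕ → ℕ
  intoEdge zero φ = 0
  intoEdge (suc t) φ = edgePot (c ∸ 1) t φ

  outOfA : ℕ → ℕ → ℕ
  outOfA zero φ⁺ = 2 * φ⁺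
  outOfA (suc t) φ⁺ = 0

  intoEdge≤ : ∀ t φ → intoEdge t φ ≤ 2 ^ (t / c) * φ
  intoEdge≤ zero φ = z≤n
  intoEdge≤ (suc t) φ with (c ∸ 1) ≤ᵇ t in e
  ... | false = z≤n
  ... | true = ≤-reflexive (begin
      2 * 2 ^ ((t ∸ (c ∸ 1)) / c) * φ ≡⟨ cong (λ z → 2 * 2 ^ (z / c) * φ) (trans (cong (t ∸_) c∸1≡) (cong (suc t ∸_) (sym c≡))) ⟩
      2 * 2 ^ ((suc t ∸ c) / c) * φ ≡⟨ cong (λ z → 2 ^ z * φ) (sym (/c-step (suc t) c≤1+t)) ⟩
      2 ^ (suc t / c) * φ ∎)
    where
    open ≡-Reasoning
    c≤1+t : c ≤ suc t
    c≤1+t = subst (_≤ suc t) (sym (trans c≡ (cong suc (sym c∸1≡)))) (s≤s (≤ᵇ⇒≤ (c ∸ 1) t (T-true e)))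

  exit-step : ∀ t φ φ⁺ len K → len ≤ K → φ⁺ ≤ φ → 2 ≤ K →
              len * intoEdge t φ + (outOfA t φ⁺ + 0) ≤ K * 2 ^ (t / c) * φ
  exit-step zero φ φ⁺ len K lenK le K2 rewrite *-zeroʳ len | 0/n≡0 c ⦃ c-nonZero ⦄ | +-identityʳ (2 * φ⁺) =
    ≤-trans (*-mono-≤ K2 le) (≤-reflexive (cong (_* φ) (sym (*-identityʳ K))))
  exit-step (suc t) φ φ⁺ len K lenK le K2 rewrite +-identityʳ (len * intoEdge (suc t) φ) =
    ≤-trans (*-mono-≤ lenK (intoEdge≤ (suc t) φ)) (≤-reflexive (sym (*-assoc K _ φ)))

  nbrs : Fin N → List (Fin N)
  nbrs x = proj₁ (proj₂ (proj₂ cubic) x)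

  adj-sym : ∀ {x y} → T (adj x y) → T (adj y x)
  adj-sym {x} {y} e = subst T (proj₁ cubic x y) e

  adj-irrefl : ∀ {x y} → T (adj x y) → x ≢ y
  adj-irrefl {x} e refl = T-false (proj₁ (proj₂ cubic) x) e

  adj⇒∈nbrs : ∀ {x y} → T (adj x y) → y ∈ nbrs x
  adj⇒∈nbrs {x} {y} e = to (proj₂ (proj₂ (proj₂ (proj₂ (proj₂ cubic) x))) y) e

  ∈nbrs⇒adj : ∀ {x y} → y ∈ nbrs x → T (adj x y)
  ∈nbrs⇒adj {x} {y} m = from (proj₂ (proj₂ (proj₂ (proj₂ (proj₂ cubic) x))) y) m

  length-nbrs : ∀ x → length (nbrs x) ≡ 3
  length-nbrs x = proj₁ (proj₂ (proj₂ (proj₂ cubic) x))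

  pos-< : ∀ {x y} i → toℕ x < toℕ y → pos x y i ≡ ev x y i
  pos-< {x} {y} i lt with toℕ x <ᵇ toℕ y in e
  ... | true = refl
  ... | false = ⊥-elim (T-false e (<⇒<ᵇ lt))

  pos-> : ∀ {x y} i → toℕ y < toℕ x → pos x y i ≡ ev y x (cLast ∸ i)
  pos-> {x} {y} i lt with toℕ x <ᵇ toℕ y in e
  ... | true = ⊥-elim (<-asym lt (<ᵇ⇒< _ _ (T-true e)))
  ... | false = refl

  pos-ev : ∀ x y i → Σ (Fin N) λ a → Σ (Fin N) λ b → Σ ℕ λ j → pos x y i ≡ ev a b j
  pos-ev x y i with toℕ x <ᵇ toℕ y
  ... | true = x , y , i , refl
  ... | false = y , x , cLast ∸ i , refl

  cls-pos : ∀ x y i → cls (pos x y i) ≡ cX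
  cls-pos x y i with pos-ev x y i
  ... | _ , _ , _ , eq rewrite eq = refl

  pos-notLeaf : ∀ x y i → ¬ IsLeafV (pos x y i)
  pos-notLeaf x y i l with pos-ev x y i
  ... | _ , _ , _ , eq rewrite eq = l

  pos≢av : ∀ x y i z → pos x y i ≢ av z
  pos≢av x y i z e with pos-ev x y i
  ... | _ , _ , _ , eq with trans (sym eq) e
  ... | ()

  legOf-σ : ∀ {x s a p} → x ≡ Inverse.to σ ((s , a) , p) → legOf x ≡ leg s a cLast
  legOf-σ {x} {s} {a} {p} refl rewrite Inverse.inverseʳ σ {(s , a) , p} refl = refl

  nbr-av' : ∀ {x z} → Adj (av x) z → (Σ (Fin N) λ y → T (adj x y) × z ≡ pos x y 0) ⊎ (z ≡ legOf x)
  nbr-av' ad with nbr-av ad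
  ... | inj₁ (y , e , lt , refl) = inj₁ (y , e , sym (pos-< 0 lt))
  ... | inj₂ (inj₁ (y , e , lt , refl)) = inj₁ (y , adj-sym e , sym (pos-> 0 lt))
  ... | inj₂ (inj₂ (s , a , p , eq , refl)) = inj₂ (sym (legOf-σ eq))

  module ASteps (n : ℕ) (ih : BoundedBelow n) (prev : Maybe Vtx) (x : Fin N) (S0 : List (Cls × ℕ)) where

    w : Vtx
    w = av x

    notC : cls w ≢ cC
    notC ()

    viaEdge : ∀ t y → T (adj x y) → ∀ Qs → Unique Qs → All (λ Q → Cont n prev w ((cX , t) ∷ S0) (pos x y 0 ∷ Q)) Qs →
              W ((cX , t) ∷ S0) * length Qs ≤ intoEdge t (Φ S0)
    viaEdge zero y _ Qs uQ aQ = none (W ((cX , 0) ∷ S0)) 0 Qs aQ (λ Q (_ , g) →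
      seg-same-not0 w (pos x y 0) Q cX S0 notC (cls-pos x y 0) refl (Remainder.segs g))
    viaEdge (suc t') y axy Qs uQ aQ = advance1 n ih (onEdge (c ∸ 1)) ((cX , t') ∷ S0) refl enter Qs uQ aQ
      where
      enter : ∀ Q → Cont n prev w ((cX , suc t') ∷ S0) (pos x y 0 ∷ Q) →
              Inv (onEdge (c ∸ 1)) (just w) (pos x y 0) × seg (pos x y 0 ∷ Q) ≡ (cX , t') ∷ S0
      enter Q (_ , g) with seg-same⁻ w (pos x y 0) Q cX (suc t') S0 notC (cls-pos x y 0) refl (Remainder.segs g)
      ... | _ , refl , sq = (x , y , 0 , refl , axy , z≤n , c∸1≡ , refl) , sq

    -- leaving A ends the expander segment, so the weight halves
    viaLeg : ∀ t → ∀ Qs → Unique Qs → All (λ Q → Cont n prev w ((cX , t) ∷ S0) (legOf x ∷ Q)) Qs →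
             W ((cX , t) ∷ S0) * length Qs ≤ outOfA t (Φ⁺ S0)
    viaLeg (suc t') Qs uQ aQ = none (W ((cX , suc t') ∷ S0)) 0 Qs aQ (λ Q (_ , g) →
      seg-diff-notSuc w (legOf x) Q cX t' S0 notC (λ ()) (Remainder.segs g))
    viaLeg zero Qs uQ aQ = advance n ih toTree S0 2 _ refl ≤-refl leave Qs uQ aQ
      where
      lf = Inverse.from σ x
      leave : ∀ Q → Cont n prev w ((cX , 0) ∷ S0) (legOf x ∷ Q) → Inv toTree (just w) (legOf x) × seg (legOf x ∷ Q) ≡ S0
      leave Q (_ , g) = (proj₁ (proj₁ lf) , proj₂ (proj₁ lf) , cLast , proj₂ lf , refl , ≤-refl ,
                          inj₁ (refl , cong (λ z → just (av z)) (sym (Inverse.inverseˡ σ refl)))) ,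
                        proj₂ (seg-diff⁻ w (legOf x) Q cX 0 S0 notC (λ ()) (Remainder.segs g))

  count-fromA : ∀ n → BoundedBelow n → ∀ prev x t S0 (ys : List (Fin N)) K → length ys ≤ K → 2 ≤ K →
    (∀ {y} → y ∈ ys → T (adj x y)) →
    (∀ {y Q} → T (adj x y) → Cont n prev (av x) ((cX , t) ∷ S0) (pos x y 0 ∷ Q) → y ∈ ys) →
    ∀ Qs → Unique Qs → All (Cont n prev (av x) ((cX , t) ∷ S0)) Qs →
    W ((cX , t) ∷ S0) * length Qs ≤ K * 2 ^ (t / c) * Φ S0
  count-fromA n ih prev x t S0 ys K lenK 2≤K ys-adj ys-cover Qs uQ aQ =
    ≤-trans (CountByHead.countByHead _≟V_ (W ((cX , t) ∷ S0)) 0 cands Qs uQ aQ (λ { (_ , remainder _ _ _ () _) }) covered bounded)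
      (≤-trans (≤-reflexive total) (exit-step t (Φ S0) (Φ⁺ S0) (length ys) K lenK (Φ⁺≤Φ S0) 2≤K))
    where
    open ASteps n ih prev x S0
    be = intoEdge t (Φ S0)
    bl = outOfA t (Φ⁺ S0)
    edgeCand : Fin N → Vtx × ℕ
    edgeCand y = pos x y 0 , be
    cands = map edgeCand ys ++ ((legOf x , bl) ∷ [])
    total : sum (map proj₂ cands) ≡ length ys * be + (bl + 0)
    total = trans (sum-++ (map edgeCand ys) _) (cong (_+ (bl + 0)) (sum-const (λ y → pos x y 0) be ys))
    covered : ∀ {y Q} → Cont n prev w ((cX , t) ∷ S0) (y ∷ Q) → Σ ℕ λ b → (y , b) ∈ cands
    covered c@(_ , g) with nbr-av' (next-adj g)
    ... | inj₁ (y , e , refl) = be , ∈-++⁺ˡ (∈-map⁺ edgeCand (ys-cover e c))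
    ... | inj₂ refl = bl , ∈-++⁺ʳ (map edgeCand ys) (here refl)
    bounded : ∀ {y b} → (y , b) ∈ cands → ∀ Qs → Unique Qs → All (λ Q → Cont n prev w ((cX , t) ∷ S0) (y ∷ Q)) Qs →
              W ((cX , t) ∷ S0) * length Qs ≤ b
    bounded mem Qs uQ aQ with ∈-++⁻ (map edgeCand ys) mem
    ... | inj₁ m1 with ∈-map⁻ edgeCand m1
    ...   | y , my , refl = viaEdge t y (ys-adj my) Qs uQ aQ
    bounded mem Qs uQ aQ | inj₂ (here refl) = viaLeg t Qs uQ aQ

  -- on entering A all three edges are available
  count-entered : ∀ n → BoundedBelow n → ∀ prev w S → Inv entered prev w → ∀ Qs → Unique Qs →
                  All (Cont n prev w S) Qs → W S * length Qs ≤ pot entered S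
  count-entered n ih prev .(av x) [] (x , refl) Qs uQ aQ = wrongClass (av x) [] 0 (λ ()) (λ _ _ ()) Qs aQ
  count-entered n ih prev .(av x) ((cC , t) ∷ S0) (x , refl) Qs uQ aQ = wrongClass (av x) _ 0 (λ ()) (λ _ _ ()) Qs aQ
  count-entered n ih prev .(av x) ((cT , t) ∷ S0) (x , refl) Qs uQ aQ = wrongClass (av x) _ _ (λ ()) (λ _ _ ()) Qs aQ
  count-entered n ih prev .(av x) ((cX , t) ∷ S0) (x , refl) Qs uQ aQ =
    count-fromA n ih prev x t S0 (nbrs x) 3 (≤-reflexive (length-nbrs x)) (s≤s (s≤s z≤n))
      ∈nbrs⇒adj (λ e _ → adj⇒∈nbrs e) Qs uQ aQ

  -- after arriving along the edge from y0, only the two other edges are available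
  count-inA : ∀ n → BoundedBelow n → ∀ prev w S → Inv inA prev w → ∀ Qs → Unique Qs →
              All (Cont n prev w S) Qs → W S * length Qs ≤ pot inA S
  count-inA n ih .(just (pos x y0 0)) .(av x) [] (x , y0 , refl , a0 , refl) Qs uQ aQ =
    wrongClass (av x) [] 0 (λ ()) (λ _ _ ()) Qs aQ
  count-inA n ih .(just (pos x y0 0)) .(av x) ((cC , t) ∷ S0) (x , y0 , refl , a0 , refl) Qs uQ aQ =
    wrongClass (av x) _ 0 (λ ()) (λ _ _ ()) Qs aQ
  count-inA n ih .(just (pos x y0 0)) .(av x) ((cT , t) ∷ S0) (x , y0 , refl , a0 , refl) Qs uQ aQ =
    wrongClass (av x) _ 0 (λ ()) (λ _ _ ()) Qs aQ
  count-inA n ih .(just (pos x y0 0)) .(av x) ((cX , t) ∷ S0) (x , y0 , refl , a0 , refl) Qs uQ aQ =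
    count-fromA n ih _ x t S0 others 2 len≤2 ≤-refl
      (λ my → ∈nbrs⇒adj (proj₁ (∈-filter⁻ notY0 my))) cover Qs uQ aQ
    where
    notY0 : ∀ y → Dec (¬ y ≡ y0)
    notY0 y = ¬? (y FinP.≟ y0)
    others = filter notY0 (nbrs x)
    len≤2 : length others ≤ 2
    len≤2 = s≤s⁻¹ (≤-trans (ListP.filter-notAll notY0 (nbrs x) (Any.map (λ { refl ne → ne refl }) (adj⇒∈nbrs a0)))
                           (≤-reflexive (length-nbrs x)))
    cover : ∀ {y Q} → T (adj x y) → Cont n _ (av x) ((cX , t) ∷ S0) (pos x y 0 ∷ Q) → y ∈ others
    cover {y} e (_ , g) with y FinP.≟ y0
    ... | yes refl = ⊥-elim (next-≢prev g refl)
    ... | no ne = ∈-filter⁺ notY0 (adj⇒∈nbrs e) ne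

  PosNbr : Fin N → Fin N → ℕ → Vtx → Set
  PosNbr x y i z = (z ≡ prevOnEdge x y i) ⊎ (suc i ≤ cLast × z ≡ pos x y (suc i)) ⊎ (i ≡ cLast × z ≡ av y)

  nbr-pos : ∀ {x y i z} → T (adj x y) → i ≤ cLast → Adj (pos x y i) z → PosNbr x y i z
  nbr-pos {x} {y} {i} {z} axy le ad with <-cmp (toℕ x) (toℕ y)
  ... | tri≈ _ eq _ = ⊥-elim (adj-irrefl axy (FinP.toℕ-injective eq))
  ... | tri< lt _ _ = forward (nbr-ev (subst (λ v → Adj v z) (pos-< i lt) ad))
    where
    forward : EdgeNbr x y i z → PosNbr x y i z
    forward (inj₁ (lt' , refl)) = inj₂ (inj₁ (c∸1-lt lt' , sym (pos-< (suc i) lt)))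
    forward (inj₂ (inj₁ (eq , refl))) = inj₂ (inj₂ (eq , refl))
    forward (inj₂ (inj₂ (inj₁ (j' , refl , refl)))) = inj₁ (sym (pos-< j' lt))
    forward (inj₂ (inj₂ (inj₂ (refl , refl)))) = inj₁ refl
  ... | tri> _ _ gt = backward i le (nbr-ev (subst (λ v → Adj v z) (pos-> i gt) ad))
    where
    backward : ∀ i → i ≤ cLast → EdgeNbr y x (cLast ∸ i) z → PosNbr x y i z
    backward zero le (inj₁ (lt' , refl)) = ⊥-elim (<-irrefl refl (≤-trans lt' (≤-reflexive c∸1≡)))
    backward (suc i') le (inj₁ (lt' , refl)) =
      inj₁ (trans (cong (ev y x) (sym (∸-step cLast i' le))) (sym (pos-> i' gt)))
    backward i le (inj₂ (inj₁ (eq , refl))) with ∸-cancelˡ-≡ le z≤n eq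
    ... | refl = inj₁ refl
    backward i le (inj₂ (inj₂ (inj₁ (j' , eqj , refl)))) =
      inj₂ (inj₁ (i<cLast , trans (cong (ev y x) (suc-injective (trans (sym eqj) (∸-step cLast i i<cLast)))) (sym (pos-> (suc i) gt))))
      where
      i<cLast : i < cLast
      i<cLast = ≰⇒> (λ cLast≤i → case trans (sym (m≤n⇒m∸n≡0 cLast≤i)) eqj of λ ())
    backward i le (inj₂ (inj₂ (inj₂ (eq0 , refl)))) = inj₂ (inj₂ (≤-antisym le (m∸n≡0⇒m≤n eq0) , refl))

  pos-end : ∀ {x y} → T (adj x y) → pos x y cLast ≡ pos y x 0
  pos-end {x} {y} axy with <-cmp (toℕ x) (toℕ y)
  ... | tri≈ _ eq _ = ⊥-elim (adj-irrefl axy (FinP.toℕ-injective eq))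
  ... | tri< lt _ _ = trans (pos-< cLast lt) (sym (pos-> {y} {x} 0 lt))
  ... | tri> _ _ gt = trans (pos-> cLast gt) (trans (cong (ev y x) (n∸n≡0 cLast)) (sym (pos-< {y} {x} 0 gt)))

  alongEdge : ℕ → ℕ → ℕ → ℕ
  alongEdge i zero φ = 0
  alongEdge i (suc t) φ = if suc i ≤ᵇ cLast then edgePot (cLast ∸ i) t φ else 0

  arriveAtEnd : ℕ → ℕ → ℕ → ℕ
  arriveAtEnd i zero φ = 0
  arriveAtEnd i (suc t) φ = if i ≡ᵇ cLast then 2 * 2 ^ (t / c) * φ else 0

  edge-step : ∀ i t φ → i ≤ cLast → alongEdge i t φ + (arriveAtEnd i t φ + 0) ≤ edgePot (suc (cLast ∸ i)) t φ
  edge-step i zero φ le = z≤n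
  edge-step i (suc t) φ le with suc i ≤ᵇ cLast in e1 | i ≡ᵇ cLast in e2
  ... | true | true =
    ⊥-elim (<-irrefl refl (≤-trans (≤ᵇ⇒≤ (suc i) cLast (T-true e1)) (≤-reflexive (sym (≡ᵇ⇒≡ i cLast (T-true e2))))))
  ... | true | false rewrite ≤ᵇ-suc (cLast ∸ i) t = ≤-reflexive (+-identityʳ _)
  ... | false | false = z≤n
  ... | false | true with ≡ᵇ⇒≡ i cLast (T-true e2)
  ...   | refl rewrite n∸n≡0 i = ≤-reflexive (+-identityʳ _)

  pos-notC : ∀ x y i → cls (pos x y i) ≢ cC
  pos-notC x y i e with trans (sym (cls-pos x y i)) e
  ... | ()

  module EdgeSteps (n : ℕ) (ih : BoundedBelow n) (x y : Fin N) (i : ℕ) (axy : T (adj x y)) (i≤ : i ≤ cLast)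
                   (S0 : List (Cls × ℕ)) where

    w : Vtx
    w = pos x y i

    prev : Maybe Vtx
    prev = just (prevOnEdge x y i)

    sameClass : cls (pos x y (suc i)) ≡ cls w
    sameClass = trans (cls-pos x y (suc i)) (sym (cls-pos x y i))

    onwards : ∀ t Qs → Unique Qs → All (λ Q → Cont n prev w ((cX , t) ∷ S0) (pos x y (suc i) ∷ Q)) Qs →
              W ((cX , t) ∷ S0) * length Qs ≤ alongEdge i t (Φ S0)
    onwards zero Qs uQ aQ = none (W ((cX , 0) ∷ S0)) 0 Qs aQ (λ Q (_ , g) →
      seg-same-not0 w (pos x y (suc i)) Q cX S0 (pos-notC x y i) sameClass (cls-pos x y i) (Remainder.segs g))
    onwards (suc t') Qs uQ aQ with suc i ≤ᵇ cLast in e1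
    ... | false = none (W ((cX , suc t') ∷ S0)) 0 Qs aQ (λ Q (_ , g) → blocked g (nbr-pos axy i≤ (next-adj g)))
      where
      blocked : ∀ {Q} → Remainder prev (w ∷ pos x y (suc i) ∷ Q) ((cX , suc t') ∷ S0) →
                ¬ PosNbr x y i (pos x y (suc i))
      blocked g (inj₁ eq) = next-≢prev g (sym eq)
      blocked g (inj₂ (inj₁ (le , _))) = T-false e1 (≤⇒≤ᵇ le)
      blocked g (inj₂ (inj₂ (_ , eq))) = pos≢av x y (suc i) y eq
    ... | true = advance1 n ih (onEdge (cLast ∸ i)) ((cX , t') ∷ S0) refl step Qs uQ aQ
      where
      le = ≤ᵇ⇒≤ (suc i) cLast (T-true e1)
      step : ∀ Q → Cont n prev w ((cX , suc t') ∷ S0) (pos x y (suc i) ∷ Q) →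
             Inv (onEdge (cLast ∸ i)) (just w) (pos x y (suc i)) × seg (pos x y (suc i) ∷ Q) ≡ (cX , t') ∷ S0
      step Q (_ , g) with seg-same⁻ w (pos x y (suc i)) Q cX (suc t') S0 (pos-notC x y i) sameClass (cls-pos x y i) (Remainder.segs g)
      ... | _ , refl , sq = (x , y , suc i , refl , axy , le , ∸-step cLast i le , refl) , sq

    arrive : ∀ t Qs → Unique Qs → All (λ Q → Cont n prev w ((cX , t) ∷ S0) (av y ∷ Q)) Qs →
             W ((cX , t) ∷ S0) * length Qs ≤ arriveAtEnd i t (Φ S0)
    arrive zero Qs uQ aQ = none (W ((cX , 0) ∷ S0)) 0 Qs aQ (λ Q (_ , g) →
      seg-same-not0 w (av y) Q cX S0 (pos-notC x y i) (sym (cls-pos x y i)) (cls-pos x y i) (Remainder.segs g))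
    arrive (suc t') Qs uQ aQ with i ≡ᵇ cLast in e2
    ... | false = none (W ((cX , suc t') ∷ S0)) 0 Qs aQ (λ Q (_ , g) → blocked g (nbr-pos axy i≤ (next-adj g)))
      where
      blocked : ∀ {Q} → Remainder prev (w ∷ av y ∷ Q) ((cX , suc t') ∷ S0) →
                ¬ PosNbr x y i (av y)
      blocked g (inj₁ eq) = next-≢prev g (sym eq)
      blocked g (inj₂ (inj₁ (_ , eq))) = pos≢av x y (suc i) y (sym eq)
      blocked g (inj₂ (inj₂ (eq , _))) = T-false e2 (≡⇒≡ᵇ i cLast eq)
    ... | true = advance1 n ih inA ((cX , t') ∷ S0) refl step Qs uQ aQ
      where
      i≡cLast = ≡ᵇ⇒≡ i cLast (T-true e2)
      step : ∀ Q → Cont n prev w ((cX , suc t') ∷ S0) (av y ∷ Q) → Inv inA (just w) (av y) × seg (av y ∷ Q) ≡ (cX , t') ∷ S0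
      step Q (_ , g) with seg-same⁻ w (av y) Q cX (suc t') S0 (pos-notC x y i) (sym (cls-pos x y i)) (cls-pos x y i) (Remainder.segs g)
      ... | _ , refl , sq = (y , x , refl , adj-sym axy , cong just (trans (cong (pos x y) i≡cLast) (pos-end axy))) , sq

  count-onEdge : ∀ n → BoundedBelow n → ∀ jr prev w S → Inv (onEdge jr) prev w → ∀ Qs → Unique Qs →
                 All (Cont n prev w S) Qs → W S * length Qs ≤ pot (onEdge jr) S
  count-onEdge n ih .(suc (cLast ∸ i)) .(just (prevOnEdge x y i)) .(pos x y i) S (x , y , i , refl , axy , i≤ , refl , refl) Qs uQ aQ =
    byClass S refl
    where
    wrongX : ∀ S' → S' ≡ S → (∀ n rest → S' ≢ (cX , n) ∷ rest) → W S * length Qs ≤ 0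
    wrongX S' refl f =
      wrongClass (pos x y i) S 0 (pos-notC x y i) (λ n rest eq → f n rest (trans eq (cong (λ d → (d , n) ∷ rest) (cls-pos x y i)))) Qs aQ
    byClass : ∀ S' → S' ≡ S → W S * length Qs ≤ pot (onEdge (suc (cLast ∸ i))) S
    byClass [] refl = wrongX [] refl (λ _ _ ())
    byClass ((cT , t) ∷ S0) refl = wrongX _ refl (λ _ _ ())
    byClass ((cC , t) ∷ S0) refl = wrongX _ refl (λ _ _ ())
    byClass ((cX , t) ∷ S0) refl =
      ≤-trans (CountByHead.countByHead _≟V_ (W S) 0 cands Qs uQ aQ (λ { (_ , remainder _ _ _ el _) → ⊥-elim (pos-notLeaf x y i el) })
                 covered bounded)
        (edge-step i t (Φ S0) i≤)
      where
      open EdgeSteps n ih x y i axy i≤ S0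
      cands = (pos x y (suc i) , alongEdge i t (Φ S0)) ∷ (av y , arriveAtEnd i t (Φ S0)) ∷ []
      covered : ∀ {z Q} → Cont n prev w S (z ∷ Q) → Σ ℕ λ b → (z , b) ∈ cands
      covered (_ , g) with nbr-pos axy i≤ (next-adj g)
      ... | inj₁ eq = ⊥-elim (next-≢prev g (sym eq))
      ... | inj₂ (inj₁ (_ , refl)) = _ , here refl
      ... | inj₂ (inj₂ (_ , refl)) = _ , there (here refl)
      bounded : ∀ {z b} → (z , b) ∈ cands → ∀ Qs → Unique Qs → All (λ Q → Cont n prev w S (z ∷ Q)) Qs → W S * length Qs ≤ b
      bounded (here refl) = onwards t
      bounded (there (here refl)) = arrive t

  count-step : ∀ n → BoundedBelow n → Bounded n
  count-step n ih (ascend e) = count-ascend n ih e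
  count-step n ih (descend e) = count-descend n ih e
  count-step n ih toA = count-toA n ih
  count-step n ih toTree = count-toTree n ih
  count-step n ih entered = count-entered n ih
  count-step n ih inA = count-inA n ih
  count-step n ih (onEdge jr) = count-onEdge n ih jr

  count : ∀ n → Bounded n
  count zero = count-step zero (λ _ ())
  count (suc n) = count-step (suc n) (λ { n' refl → count n' })

  HeadIs : Vtx → List Vtx → Set
  HeadIs x P = Σ (List Vtx) λ Q → P ≡ x ∷ Q

  tail : List Vtx → List Vtx
  tail [] = []
  tail (_ ∷ Q) = Q

  tail-Unique : ∀ x Ps → All (HeadIs x) Ps → Unique Ps → Unique (map tail Ps)
  tail-Unique x [] [] [] = []
  tail-Unique x (.(x ∷ Q) ∷ Ps) ((Q , refl) ∷ hs) (a ∷ u) = distinct Ps hs a ∷ tail-Unique x Ps hs u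
    where
    distinct : ∀ Ps' → All (HeadIs x) Ps' → All ((x ∷ Q) ≢_) Ps' → All (Q ≢_) (map tail Ps')
    distinct [] [] [] = []
    distinct (P' ∷ Ps') ((Q' , refl) ∷ hs') (ne ∷ nes) = (λ eq → ne (cong (x ∷_) eq)) ∷ distinct Ps' hs' nes

  maxLength : List (List Vtx) → ℕ
  maxLength [] = 0
  maxLength (Q ∷ Qs) = length Q ⊔ maxLength Qs

  endsAtLeaf-∷ʳ : ∀ (xs : List Vtx) y → IsLeafV y → EndsAtLeaf (xs ∷ʳ y)
  endsAtLeaf-∷ʳ [] y l = l
  endsAtLeaf-∷ʳ (x ∷ []) y l = l
  endsAtLeaf-∷ʳ (x ∷ x' ∷ xs) y l = endsAtLeaf-∷ʳ (x' ∷ xs) y l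

  -- starting at the leaf u, the walk ascends from height 0
  start-pot : ∀ S → pot (ascend 0) S ≤ Φ S
  start-pot [] = z≤n
  start-pot ((cT , t) ∷ S0) = ≤-reflexive (cong (λ z → lam k ⌊ z /2⌋ * Φ S0) (+-identityʳ t))
  start-pot ((cC , t) ∷ S0) = z≤n
  start-pot ((cX , t) ∷ S0) = z≤n

  paths-bounded : ∀ (u : List ℕ) → T (isLeaf k u) → ∀ S (Ps : List (List Vtx)) → Unique Ps →
                  All (λ P → InPaths u P × seg P ≡ S) Ps → W S * length Ps ≤ Φ S
  paths-bounded u lf S Ps uPs aPs = ≤-trans
    (subst (λ z → W S * z ≤ pot (ascend 0) S) (ListP.length-map tail Ps)
      (count (maxLength (map tail Ps)) (ascend 0) nothing (tr L u) S
        (L , u , refl , proj₁ (leaf-valid {u} lf) , proj₂ (leaf-valid {u} lf))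
        (map tail Ps) (tail-Unique (tr L u) Ps (All.map startsAtU aPs) uPs) (continuations Ps aPs)))
    (start-pot S)
    where
    startsAtU : ∀ {P} → InPaths u P × seg P ≡ S → HeadIs (tr L u) P
    startsAtU ((mid , w' , lw , refl , _) , _) = (mid ∷ʳ tr R w') , refl
    continuations : ∀ Ps' → All (λ P → InPaths u P × seg P ≡ S) Ps' →
                    All (Cont (maxLength (map tail Ps')) nothing (tr L u) S) (map tail Ps')
    continuations [] [] = []
    continuations (P ∷ Ps') (((mid , w' , lw , refl , lk , un , ns) , sg) ∷ rest) =
      (m≤m⊔n (length (mid ∷ʳ tr R w')) _ , remainder lk un ns (endsAtLeaf-∷ʳ (tr L u ∷ mid) (tr R w') lw) sg) ∷
      All.map (λ { (le , g) → ≤-trans le (m≤n⊔m (length (mid ∷ʳ tr R w')) _) , g }) (continuations Ps' rest)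

  ⌊2*t/2⌋ : ∀ t → ⌊ 2 * t /2⌋ ≡ t
  ⌊2*t/2⌋ t = trans (cong ⌊_/2⌋ (cong (t +_) (+-identityʳ t))) (half-double t)

  c*e/c : ∀ e → c * e / c ≡ e
  c*e/c e = trans (cong (_/ c) (*-comm c e)) (m*n/n≡m e c)

  length-odd : ∀ r t e (ts : List ℕ) → length (t ∷ e ∷ ts) ≡ 2 * suc r + 1 → length ts ≡ 2 * r + 1
  length-odd r t e ts eq = suc-injective (suc-injective (trans eq (cong (_+ 1) (*-suc 2 r))))

  length-not1 : ∀ r → 1 ≢ 2 * suc r + 1
  length-not1 r eq = case trans eq (cong (_+ 1) (*-suc 2 r)) of λ ()

  countX-scale : ∀ r ts → length ts ≡ 2 * r + 1 → countX (scaleT c ts) ≡ r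
  countX-scale zero (t ∷ []) eq = refl
  countX-scale (suc r) (t ∷ []) eq = ⊥-elim (length-not1 r eq)
  countX-scale (suc r) (t ∷ e ∷ ts) eq = cong suc (countX-scale r ts (length-odd r t e ts eq))

  Φ-scale : ∀ r ts → length ts ≡ 2 * r + 1 → Φ (scaleT c ts) ≡ 3 ^ r * bound k ts
  Φ-scale zero (t ∷ []) eq rewrite ⌊2*t/2⌋ t = trans (*-identityʳ _) (sym (+-identityʳ _))
  Φ-scale (suc r) (t ∷ []) eq = ⊥-elim (length-not1 r eq)
  Φ-scale (suc r) (t ∷ e ∷ ts) eq rewrite ⌊2*t/2⌋ t | c*e/c e | Φ-scale r ts (length-odd r t e ts eq) =
    solve 4 (λ Λ P R B → Λ :* (con 3 :* P :* (R :* B)) := (con 3 :* R) :* (Λ :* P :* B)) refl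
      (lam k t) (2 ^ e) (3 ^ r) (bound k ts)
    where open +-*-Solver using (solve; _:*_; _:=_; con)

mainTheorem6 : (k m : ℕ) → 1 ≤ k → 1 ≤ m →
    (adj : Fin (nA k) → Fin (nA k) → Bool) → IsCubic adj →
    (σ : Leaf k ↔ Fin (nA k)) →
    (u : List ℕ) → T (isLeaf k u) →
    (r : ℕ) → 1 ≤ r → (ts : List ℕ) → length ts ≡ 2 * r + 1 →
    (Ps : List (List (V (nA k)))) → Unique Ps →
    All (λ P → Graph.InPaths k m adj σ u P × rank P ≡ r × HasPattern (2 * m) P ts) Ps →
    2 ^ r * length Ps ≤ 3 ^ r * bound k ts
mainTheorem6 k .(suc m') _ (s≤s {n = m'} z≤n) adj cubic σ u u-leaf r _ ts len Ps uPs aPs =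
  subst₂ (λ a b → a * length Ps ≤ b) (cong (2 ^_) (countX-scale r ts len)) (Φ-scale r ts len)
    (paths-bounded u u-leaf (scaleT c ts) Ps uPs (All.map (λ (inP , _ , pat) → inP , pat) aPs))
  where open Counting k m' adj cubic σ
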